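{- Let $\alpha$ and $\beta$ be compositions of $n$ and let $(T,S)\in C_{\alpha,\beta}$. (1) If $\alpha=\beta$, then $\psi_{\alpha,\alpha}(T,S)=(T,S)$. (2) If $\alpha\neq\beta$, then $(V,U):=\psi_{\alpha,\beta}(T,S)$ satisfies (a) $\operatorname{sgn}(V)=-\operatorname{sgn}(T)$ and (b) $\psi_{\alpha,\beta}(V,U)=(T,S)$.
   Context: A composition of $n$ is a finite sequence of positive integers summing to $n$. For a composition $\gamma=(\gamma_1,\dots,\gamma_\ell)$, its diagram has cells $(i,j)$, $1\le i\le\ell$, $1\le j\le\gamma_i$ (row $i$ from the top). An immaculate tableau of shape $\gamma$ is a filling by positive integers with rows weakly increasing left to right and first column strictly increasing top to bottom; its content counts entries of each value. For an integer sequence $a$, $\operatorname{fl}(a)$ deletes its zero entries. Permutations are in one-line notation, $s_i=(i,i+1)$, products compose right to left. Tunnel hook coverings (THCs), introduced by Allen and Mason; only these facts are needed: for a composition $\gamma=(\gamma_1,\dots,\gamma_\ell)$, each THC $T$ of shape $\gamma$ has a permutation $\operatorname{perm}(T)\in S_\ell$, and $T\mapsto\operatorname{perm}(T)$ is a bijection from THCs of shape $\gamma$ onto $S_\ell$; $\operatorname{sgn}(T)=\operatorname{sgn}(\operatorname{perm}(T))$; $\Delta_i(T)=\gamma_i+\sigma_i-i$ for $\sigma=\operatorname{perm}(T)$; the content of $T$ is $\operatorname{fl}(\Delta(T))$. $C_{\alpha,\beta}$ is the set of pairs $(T,S)$ with $T$ a THC of content $\alpha$, $S$ an immaculate tableau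 of content $\beta$, and $T,S$ of the same shape. The map $\psi_{\alpha,\beta}$: let $(T,S)\in C_{\alpha,\beta}$, $\sigma=\operatorname{perm}(T)$, common shape $\gamma=(\gamma_1,\dots,\gamma_\ell)$, and $M$ the maximum entry of $S$. (1) Let $k$ be the smallest nonnegative integer less than $\ell$ such that for all $i\in\{k+1,\dots,\ell\}$: (a) $\sigma_i=i$; (b) row $i$ of $S$ contains no entries other than $M-\ell+i$; (c) $M-\ell+i$ appears only in row $i$ of $S$. If no such $k$ exists, set $k=\ell$. (2) If $k=0$, set $\psi_{\alpha,\beta}(T,S)=(T,S)$. (3) Otherwise let $\mathcal R=\{\sigma_j: M-\ell+k \text{ appears in row } j \text{ of } S\}$ and choose $r$ with $\sigma_r$ minimal in $\mathcal R$. (4) If $\sigma_r=k$: delete the rightmost entry of row $r$ of $S$ and then insert a new row consisting of a single cell with entry $M-\ell+k$ between rows $k$ and $k+1$ (it becomes row $k+1$), obtaining $U$; regard $\sigma$ as an element of $S_{\ell+1}$ fixing $\ell+1$, and let $V$ be the THC of shape $\operatorname{sh}(U)$ with $\operatorname{perm}(V)=s_k\sigma$. (5) If $\sigma_r\neq k$: delete the rightmost entry of row $r$ of $S$, set $q=\sigma_r$, and append a cell with entry $M-\ell+k$ to the end of row $p=\sigma^{ -1}(q+1)$, obtaining $U$; if row $r$ of $U$ is now empty, delete it, shifting rows $r+1,\dots,\ell$ up. Let $V$ be the THC of shape $\operatorname{sh}(U)$ with $\operatorname{perm}(V)=s_q\sigma$. Set $\psi_{\alpha,\beta}(T,S)=(V,U)$.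 -}

module Defs where

open import Data.Nat using (ℕ; zero; suc; _+_; _∸_; _≤_; _<_; _⊔_; _≡ᵇ_; _<ᵇ_)
open import Data.Integer as ℤ using (ℤ; +_; _-_; -_; _*_; 1ℤ; -1ℤ; 0ℤ)
open import Data.Bool using (Bool; true; false; if_then_else_; _∧_; _∨_; not)
open import Data.List using (List; []; _∷_; _++_; [_]; length; map; filter; concat; foldr; upTo)
open import Data.Nat.ListAction using (sum)
open import Data.Bool.ListAction using (all; any)
open import Data.List.Relation.Unary.All using (All)
open import Data.List.Relation.Unary.Linked using (Linked)
open import Data.List.Relation.Binary.Permutation.Propositional using (_↭_)
open import Data.Maybe using (Maybe; just; nothing)
open import Data.Product using (_×_; _,_)
open import Relation.Binary.PropositionalEquality using (_≡_; _≢_)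
open import Relation.Nullary using (¬?)

nth : List ℕ → ℕ → ℕ
nth []       _       = 0
nth (x ∷ xs) zero    = x
nth (x ∷ xs) (suc i) = nth xs i

rowAt : List (List ℕ) → ℕ → List ℕ
rowAt []       _       = []
rowAt (x ∷ xs) zero    = x
rowAt (x ∷ xs) (suc i) = rowAt xs i

updateAt : {A : Set} → ℕ → (A → A) → List A → List A
updateAt _       f []       = []
updateAt zero    f (x ∷ xs) = f x ∷ xs
updateAt (suc i) f (x ∷ xs) = x ∷ updateAt i f xs

insertAt : {A : Set} → ℕ → A → List A → List A
insertAt zero    a xs       = a ∷ xs
insertAt (suc i) a []       = a ∷ []
insertAt (suc i) a (x ∷ xs) = x ∷ insertAt i a xs

removeAt : {A : Set} → ℕ → List A → List A
removeAt _       []       = []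
removeAt zero    (x ∷ xs) = xs
removeAt (suc i) (x ∷ xs) = x ∷ removeAt i xs

dropLast : {A : Set} → List A → List A
dropLast []           = []
dropLast (x ∷ [])     = []
dropLast (x ∷ y ∷ xs) = x ∷ dropLast (y ∷ xs)

isEmpty : {A : Set} → List A → Bool
isEmpty [] = true
isEmpty (_ ∷ _) = false

countL : ℕ → List ℕ → ℕ
countL v []       = 0
countL v (x ∷ xs) = (if v ≡ᵇ x then 1 else 0) + countL v xs

-- 1-based position of value v in a list (σ⁻¹(v) for a one-line permutation)
posOf : ℕ → List ℕ → Maybe ℕ
posOf v []       = nothing
posOf v (x ∷ xs) with v ≡ᵇ x
... | true  = just 1
... | false with posOf v xs
...   | just j  = just (suc j)
...   | nothing = nothing

IsComposition : ℕ → List ℕ → Set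
IsComposition n α = All (λ x → 1 ≤ x) α × sum α ≡ n

-- Permutations of {1,…,ℓ} in one-line notation, as lists

IsPerm : List ℕ → Set
IsPerm σ = σ ↭ map suc (upTo (length σ))

-- s_k σ (s_k applied after σ): swap the VALUES k and k+1
sAct : ℕ → List ℕ → List ℕ
sAct k = map (λ x → if x ≡ᵇ k then suc k else (if x ≡ᵇ suc k then k else x))

countLess : ℕ → List ℕ → ℕ
countLess x []       = 0
countLess x (y ∷ ys) = (if y <ᵇ x then 1 else 0) + countLess x ys

inversions : List ℕ → ℕ
inversions []       = 0
inversions (x ∷ xs) = countLess x xs + inversions xs

negOnePow : ℕ → ℤ
negOnePow zero    = 1ℤ
negOnePow (suc m) = - negOnePow m

sgn : List ℕ → ℤ
sgn σ = negOnePow (inversions σ)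

-- Tableaux: a filling of a composition diagram is its list of rows
-- (row i from the top is the i-th list).

shape : List (List ℕ) → List ℕ
shape = map length

firstCol : List (List ℕ) → List ℕ
firstCol []             = []
firstCol ([] ∷ rs)      = firstCol rs
firstCol ((x ∷ _) ∷ rs) = x ∷ firstCol rs

NonEmpty : List ℕ → Set
NonEmpty r = 1 ≤ length r

IsImmaculate : List (List ℕ) → Set
IsImmaculate S =
  All NonEmpty S × All (All (λ x → 1 ≤ x)) S × All (Linked _≤_) S × Linked _<_ (firstCol S)

countT : ℕ → List (List ℕ) → ℕ
countT v S = sum (map (countL v) S)

-- content of S equals the composition β: value v+1 occurs β_{v+1} times
-- (and 0 times for v+1 > ℓ(β)); entries are positive so nothing else occurs
HasContentT : List (List ℕ) → List ℕ → Set
HasContentT S β = ∀ v → countT (suc v) S ≡ nth β v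

-- Tunnel hook coverings.  A THC of shape γ is determined by (and is
-- identified with) perm(T) ∈ S_ℓ; we represent T by perm(T) in one-line
-- notation, the shape being carried separately.

deltaFrom : ℕ → List ℕ → List ℕ → List ℤ
deltaFrom i (g ∷ γ) (s ∷ σ) = (+ g ℤ.+ + s) - + i ∷ deltaFrom (suc i) γ σ
deltaFrom i _ _ = []

Δ : List ℕ → List ℕ → List ℤ
Δ γ σ = deltaFrom 1 γ σ

fl : List ℤ → List ℤ
fl = filter (λ z → ¬? (z ℤ.≟ 0ℤ))

HasContentTHC : List ℕ → List ℕ → List ℕ → Set
HasContentTHC γ σ α = fl (Δ γ σ) ≡ map +_ α

-- (σ , S) ∈ C_{α,β}: σ = perm(T) for a THC T of the same shape as S
InC : List ℕ → List ℕ → List ℕ → List (List ℕ) → Set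
InC α β σ S =
  IsPerm σ × length σ ≡ length S × IsImmaculate S ×
  HasContentTHC (shape S) σ α × HasContentT S β

maxEntry : List (List ℕ) → ℕ
maxEntry S = foldr _⊔_ 0 (concat S)

module PsiAux (σ : List ℕ) (S : List (List ℕ)) where
  ℓ M : ℕ
  ℓ = length S
  M = maxEntry S

  -- e = M - ℓ + i  (as integers)
  isVal : ℕ → ℕ → Bool
  isVal i e = (e + ℓ) ≡ᵇ (M + i)

  occursElsewhere : ℕ → ℕ → List (List ℕ) → Bool
  occursElsewhere i j []       = false
  occursElsewhere i j (r ∷ rs) =
    ((not (j ≡ᵇ i)) ∧ any (isVal i) r) ∨ occursElsewhere i (suc j) rs

  -- conditions (a),(b),(c) for the 1-based row index i
  good : ℕ → Bool
  good i = (nth σ (i ∸ 1) ≡ᵇ i) ∧ all (isVal i) (rowAt S (i ∸ 1))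
           ∧ not (occursElsewhere i 1 S)

  kFrom : ℕ → ℕ
  kFrom zero    = zero
  kFrom (suc m) = if good (suc m) then kFrom m else suc m

  k : ℕ
  k = kFrom ℓ

  x : ℕ
  x = (M + k) ∸ ℓ

  -- among 1-based rows j containing x, the one with σ_j minimal: (r , σ_r)
  best : ℕ → List ℕ → List (List ℕ) → Maybe (ℕ × ℕ) → Maybe (ℕ × ℕ)
  best j (s ∷ ss) (row ∷ rows) acc with any (isVal k) row | acc
  ... | false | _              = best (suc j) ss rows acc
  ... | true  | nothing        = best (suc j) ss rows (just (j , s))
  ... | true  | just (j' , s') =
          best (suc j) ss rows (if s <ᵇ s' then just (j , s) else just (j' , s'))
  best j _ _ acc = acc

  step5 : ℕ → ℕ → Maybe ℕ → List ℕ × List (List ℕ)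
  step5 r q nothing  = σ , S   -- q+1 not a value of σ: does not occur on C_{α,β}
  step5 r q (just p) =
    let S₁ = updateAt (r ∸ 1) dropLast S
        U  = updateAt (p ∸ 1) (λ row → row ++ [ x ]) S₁
        σ′ = sAct q σ
    in if isEmpty (rowAt U (r ∸ 1))
       then (dropLast σ′ , removeAt (r ∸ 1) U)   -- s_q σ fixes ℓ; viewed in S_{ℓ-1}
       else (σ′ , U)

  stepR : Maybe (ℕ × ℕ) → List ℕ × List (List ℕ)
  stepR nothing        = σ , S   -- 𝓡 empty: does not occur on C_{α,β}
  stepR (just (r , q)) =
    if q ≡ᵇ k
    then (sAct k (σ ++ [ suc ℓ ]) , insertAt k [ x ] (updateAt (r ∸ 1) dropLast S))
    else step5 r q (posOf (suc q) σ)

  result : List ℕ × List (List ℕ)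
  result with k
  ... | zero  = σ , S
  ... | suc _ = stepR (best 1 σ S nothing)

ψ : List ℕ → List (List ℕ) → List ℕ × List (List ℕ)
ψ σ S = PsiAux.result σ S

-- Let k be the index of step (1) of ψ.  If k = 0, then σ = id and row i of S
-- is constant M − ℓ + i; as β is a composition the value 1 occurs, so M = ℓ,
-- S is the staircase tableau and α = γ = β.  Conversely, for the weight
-- w(a) = Σ i·a_i we have w(α) ≤ w(Δ) ≤ w(γ) ≤ ΣS = w(β): dropping zeros
-- lowers weights, 2w(Δ) = 2w(γ) − Σ(σ_i − i)² because Σσ_i² = Σi², and row i
-- of an immaculate tableau has entries ≥ i.  So α = β forces all equalities,
-- hence σ = id and the staircase, i.e. k = 0.
--
-- When k > 0 the value x = M − ℓ + k occurs only above row k, and ψ either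
-- inserts a row [x] (step 4) or moves an x to row σ⁻¹(q+1) (step 5), composing
-- σ with an adjacent transposition, which flips the sign.  Applied again, ψ
-- sees the same x (k and ℓ shift together) and picks the row the x went to,
-- so step 4 and step 5 with an emptied row undo each other, while step 5
-- without emptying undoes itself.

module Submission where

open import Defs
open import Data.Nat
open import Data.Nat.Properties
open import Data.Nat.ListAction using (sum)
open import Data.Nat.ListAction.Properties using (sum-++; sum-↭)
open import Data.Nat.Solver using (module +-*-Solver)
open +-*-Solver using (solve; _:+_; _:*_; _:=_; con)
open import Data.Integer as ℤ using (ℤ; 0ℤ; -_) renaming (+_ to pos)
import Data.Integer.Properties as ℤP
open import Data.List using (List; []; _∷_; _++_; [_]; length; map; concat; foldr; upTo)
import Data.List.Properties as LP
open import Data.List.Relation.Unary.All as All using (All; []; _∷_)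
import Data.List.Relation.Unary.All.Properties as AllP
open import Data.List.Relation.Unary.Any as Any using (Any; here; there)
open import Data.List.Relation.Unary.Linked using (Linked; []; _∷_)
open import Data.List.Membership.Propositional using (_∈_)
open import Data.List.Membership.Propositional.Properties using (∈-++⁺ˡ; ∈-++⁺ʳ; ∈-++⁻)
import Data.List.Relation.Binary.Permutation.Propositional as Perm
open Perm using (_↭_)
open import Algebra.Properties.CommutativeSemigroup +-commutativeSemigroup using (x∙yz≈y∙xz)
import Data.List.Relation.Binary.Permutation.Propositional.Properties as PermP
open import Data.Bool using (Bool; true; false; if_then_else_; _∧_; _∨_; not)
open import Data.Bool.ListAction using (all; any)
open import Data.Maybe using (Maybe; just; nothing)
open import Data.Maybe.Properties using (just-injective)
open import Data.Product using (∃-syntax; _×_; _,_; proj₁; proj₂)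
open import Data.Sum using (_⊎_; inj₁; inj₂)
open import Data.Empty using (⊥; ⊥-elim)
open import Relation.Binary.PropositionalEquality hiding ([_])
open import Relation.Binary.Definitions using (tri<; tri≈; tri>)
open import Relation.Nullary using (¬_; Dec; yes; no)

≡ᵇ-refl : ∀ n → (n ≡ᵇ n) ≡ true
≡ᵇ-refl zero = refl
≡ᵇ-refl (suc n) = ≡ᵇ-refl n

≡ᵇ-true⇒≡ : ∀ m n → (m ≡ᵇ n) ≡ true → m ≡ n
≡ᵇ-true⇒≡ zero zero _ = refl
≡ᵇ-true⇒≡ zero (suc n) ()
≡ᵇ-true⇒≡ (suc m) zero ()
≡ᵇ-true⇒≡ (suc m) (suc n) e = cong suc (≡ᵇ-true⇒≡ m n e)

≢⇒≡ᵇ-false : ∀ m n → m ≢ n → (m ≡ᵇ n) ≡ false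
≢⇒≡ᵇ-false zero zero ne = ⊥-elim (ne refl)
≢⇒≡ᵇ-false zero (suc n) _ = refl
≢⇒≡ᵇ-false (suc m) zero _ = refl
≢⇒≡ᵇ-false (suc m) (suc n) ne = ≢⇒≡ᵇ-false m n (λ e → ne (cong suc e))

≡ᵇ-false⇒≢ : ∀ m n → (m ≡ᵇ n) ≡ false → m ≢ n
≡ᵇ-false⇒≢ m .m e refl with () ← trans (sym (≡ᵇ-refl m)) e

≡ᵇ-cases : ∀ m n → (m ≡ᵇ n) ≡ true × m ≡ n ⊎ (m ≡ᵇ n) ≡ false × m ≢ n
≡ᵇ-cases m n with m ≟ n
... | yes e = inj₁ (subst (λ z → (m ≡ᵇ z) ≡ true) e (≡ᵇ-refl m) , e)
... | no ne = inj₂ (≢⇒≡ᵇ-false m n ne , ne)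

<⇒<ᵇ-true : ∀ m n → m < n → (m <ᵇ n) ≡ true
<⇒<ᵇ-true zero (suc n) _ = refl
<⇒<ᵇ-true (suc m) (suc n) (s≤s p) = <⇒<ᵇ-true m n p

≤⇒<ᵇ-false : ∀ m n → n ≤ m → (m <ᵇ n) ≡ false
≤⇒<ᵇ-false m zero _ = refl
≤⇒<ᵇ-false (suc m) (suc n) (s≤s p) = ≤⇒<ᵇ-false m n p

<ᵇ-true⇒< : ∀ m n → (m <ᵇ n) ≡ true → m < n
<ᵇ-true⇒< zero (suc n) _ = s≤s z≤n
<ᵇ-true⇒< (suc m) (suc n) e = s≤s (<ᵇ-true⇒< m n e)
<ᵇ-true⇒< m zero ()

swapAdj : ℕ → ℕ → ℕ
swapAdj k x = if x ≡ᵇ k then suc k else (if x ≡ᵇ suc k then k else x)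

swapAdj-k : ∀ k → swapAdj k k ≡ suc k
swapAdj-k k rewrite ≡ᵇ-refl k = refl

swapAdj-suc : ∀ k → swapAdj k (suc k) ≡ k
swapAdj-suc k rewrite ≢⇒≡ᵇ-false (suc k) k 1+n≢n | ≡ᵇ-refl k = refl

swapAdj-fix : ∀ k v → v ≢ k → v ≢ suc k → swapAdj k v ≡ v
swapAdj-fix k v n1 n2 rewrite ≢⇒≡ᵇ-false v k n1 | ≢⇒≡ᵇ-false v (suc k) n2 = refl

swapAdj-involutive : ∀ k v → swapAdj k (swapAdj k v) ≡ v
swapAdj-involutive k v with ≡ᵇ-cases v k
... | inj₁ (e , refl) rewrite swapAdj-k v = swapAdj-suc v
... | inj₂ (e , ne) with ≡ᵇ-cases v (suc k)
...   | inj₁ (e2 , refl) rewrite swapAdj-suc k = swapAdj-k k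
...   | inj₂ (e2 , ne2) rewrite swapAdj-fix k v ne ne2 = swapAdj-fix k v ne ne2

swapAdj-fix-> : ∀ k v → suc k < v → swapAdj k v ≡ v
swapAdj-fix-> k v lt = swapAdj-fix k v (λ e → <-irrefl (sym e) (<-trans (n<1+n k) lt)) (λ e → <-irrefl (sym e) lt)

swapAdj≡k⇒ : ∀ k v → swapAdj k v ≡ k → v ≡ suc k
swapAdj≡k⇒ k v e = trans (sym (swapAdj-involutive k v)) (trans (cong (swapAdj k) e) (swapAdj-k k))

swapAdj≡suc⇒ : ∀ k v → swapAdj k v ≡ suc k → v ≡ k
swapAdj≡suc⇒ k v e = trans (sym (swapAdj-involutive k v)) (trans (cong (swapAdj k) e) (swapAdj-suc k))

nth-sAct : ∀ k σ j → j < length σ → nth (sAct k σ) j ≡ swapAdj k (nth σ j)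
nth-sAct k (x ∷ σ) zero _ = refl
nth-sAct k (x ∷ σ) (suc j) (s≤s lt) = nth-sAct k σ j lt

length-sAct : ∀ k σ → length (sAct k σ) ≡ length σ
length-sAct k σ = LP.length-map (swapAdj k) σ

sAct-involutive : ∀ k σ → sAct k (sAct k σ) ≡ σ
sAct-involutive k [] = refl
sAct-involutive k (x ∷ σ) = cong₂ _∷_ (swapAdj-involutive k x) (sAct-involutive k σ)

nth-snoc-< : ∀ σ a j → j < length σ → nth (σ ++ [ a ]) j ≡ nth σ j
nth-snoc-< (x ∷ σ) a zero _ = refl
nth-snoc-< (x ∷ σ) a (suc j) (s≤s lt) = nth-snoc-< σ a j lt

nth-snoc-last : ∀ σ a → nth (σ ++ [ a ]) (length σ) ≡ a
nth-snoc-last [] a = refl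
nth-snoc-last (x ∷ σ) a = nth-snoc-last σ a

length-snoc : ∀ {A : Set} (σ : List A) a → length (σ ++ [ a ]) ≡ suc (length σ)
length-snoc [] a = refl
length-snoc (x ∷ σ) a = cong suc (length-snoc σ a)

dropLast-snoc : ∀ {A : Set} (xs : List A) a → dropLast (xs ++ [ a ]) ≡ xs
dropLast-snoc [] a = refl
dropLast-snoc (x ∷ []) a = refl
dropLast-snoc (x ∷ y ∷ xs) a = cong (x ∷_) (dropLast-snoc (y ∷ xs) a)

dropLast-snoc-last : ∀ (τ : List ℕ) n a → length τ ≡ suc n → nth τ n ≡ a → dropLast τ ++ [ a ] ≡ τ
dropLast-snoc-last (x ∷ []) zero a _ e = cong [_] (sym e)
dropLast-snoc-last (x ∷ y ∷ τ) (suc n) a l e = cong (x ∷_) (dropLast-snoc-last (y ∷ τ) n a (suc-injective l) e)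
dropLast-snoc-last (x ∷ []) (suc n) a l e = ⊥-elim (0≢1+n (suc-injective l))
dropLast-snoc-last (x ∷ y ∷ τ) zero a l e = ⊥-elim (0≢1+n (sym (suc-injective l)))

posOf-first : ∀ v τ j → j < length τ → nth τ j ≡ v → (∀ i → i < j → nth τ i ≢ v) →
  posOf v τ ≡ just (suc j)
posOf-first v (x ∷ τ) zero _ e _ with v ≡ᵇ x in eq
... | true = refl
... | false = ⊥-elim (≡ᵇ-false⇒≢ v x eq (sym e))
posOf-first v (x ∷ τ) (suc j) (s≤s lt) e pre with v ≡ᵇ x in eq
... | true = ⊥-elim (pre 0 (s≤s z≤n) (sym (≡ᵇ-true⇒≡ v x eq)))
... | false rewrite posOf-first v τ j lt e (λ i lt' → pre (suc i) (s≤s lt')) = refl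

Tableau : Set
Tableau = List (List ℕ)

rowAt-beyond : ∀ (S : Tableau) j → length S ≤ j → rowAt S j ≡ []
rowAt-beyond [] j _ = refl
rowAt-beyond (r ∷ S) (suc j) (s≤s le) = rowAt-beyond S j le

length-updateAt : ∀ {A : Set} i (f : A → A) xs → length (updateAt i f xs) ≡ length xs
length-updateAt i f [] = refl
length-updateAt zero f (x ∷ xs) = refl
length-updateAt (suc i) f (x ∷ xs) = cong suc (length-updateAt i f xs)

rowAt-updateAt-≡ : ∀ i f (S : Tableau) → i < length S → rowAt (updateAt i f S) i ≡ f (rowAt S i)
rowAt-updateAt-≡ zero f (r ∷ S) _ = refl
rowAt-updateAt-≡ (suc i) f (r ∷ S) (s≤s lt) = rowAt-updateAt-≡ i f S lt

rowAt-updateAt-≢ : ∀ i f (S : Tableau) j → j ≢ i → rowAt (updateAt i f S) j ≡ rowAt S j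
rowAt-updateAt-≢ i f [] j ne = refl
rowAt-updateAt-≢ zero f (r ∷ S) zero ne = ⊥-elim (ne refl)
rowAt-updateAt-≢ zero f (r ∷ S) (suc j) ne = refl
rowAt-updateAt-≢ (suc i) f (r ∷ S) zero ne = refl
rowAt-updateAt-≢ (suc i) f (r ∷ S) (suc j) ne = rowAt-updateAt-≢ i f S j (λ e → ne (cong suc e))

length-insertAt : ∀ {A : Set} i (a : A) xs → i ≤ length xs → length (insertAt i a xs) ≡ suc (length xs)
length-insertAt zero a xs _ = refl
length-insertAt (suc i) a (x ∷ xs) (s≤s le) = cong suc (length-insertAt i a xs le)

rowAt-insertAt-< : ∀ i a (S : Tableau) j → j < i → i ≤ length S → rowAt (insertAt i a S) j ≡ rowAt S j
rowAt-insertAt-< (suc i) a (r ∷ S) zero _ _ = refl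
rowAt-insertAt-< (suc i) a (r ∷ S) (suc j) (s≤s lt) (s≤s le) = rowAt-insertAt-< i a S j lt le

rowAt-insertAt-≡ : ∀ i a (S : Tableau) → i ≤ length S → rowAt (insertAt i a S) i ≡ a
rowAt-insertAt-≡ zero a S _ = refl
rowAt-insertAt-≡ (suc i) a (r ∷ S) (s≤s le) = rowAt-insertAt-≡ i a S le

rowAt-insertAt-> : ∀ i a (S : Tableau) j → i ≤ j → i ≤ length S → rowAt (insertAt i a S) (suc j) ≡ rowAt S j
rowAt-insertAt-> zero a S j _ _ = refl
rowAt-insertAt-> (suc i) a (r ∷ S) (suc j) (s≤s le) (s≤s le2) = rowAt-insertAt-> i a S j le le2

length-removeAt : ∀ {A : Set} i (xs : List A) → i < length xs → suc (length (removeAt i xs)) ≡ length xs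
length-removeAt zero (x ∷ xs) _ = refl
length-removeAt (suc i) (x ∷ xs) (s≤s lt) = cong suc (length-removeAt i xs lt)

rowAt-removeAt-< : ∀ i (S : Tableau) j → j < i → rowAt (removeAt i S) j ≡ rowAt S j
rowAt-removeAt-< i [] j _ = refl
rowAt-removeAt-< (suc i) (r ∷ S) zero _ = refl
rowAt-removeAt-< (suc i) (r ∷ S) (suc j) (s≤s lt) = rowAt-removeAt-< i S j lt

rowAt-removeAt-≥ : ∀ i (S : Tableau) j → i ≤ j → rowAt (removeAt i S) j ≡ rowAt S (suc j)
rowAt-removeAt-≥ i [] j _ = refl
rowAt-removeAt-≥ zero (r ∷ S) j _ = refl
rowAt-removeAt-≥ (suc i) (r ∷ S) (suc j) (s≤s le) = rowAt-removeAt-≥ i S j le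

rowAt-ext : ∀ (A B′ : Tableau) → length A ≡ length B′ → (∀ j → j < length A → rowAt A j ≡ rowAt B′ j) → A ≡ B′
rowAt-ext [] [] _ _ = refl
rowAt-ext (a ∷ A) (b ∷ B′) l f = cong₂ _∷_ (f 0 (s≤s z≤n)) (rowAt-ext A B′ (suc-injective l) (λ j lt → f (suc j) (s≤s lt)))

length-dropLast : ∀ {A : Set} (xs : List A) → length (dropLast xs) ≡ pred (length xs)
length-dropLast [] = refl
length-dropLast (x ∷ []) = refl
length-dropLast (x ∷ y ∷ xs) = cong suc (length-dropLast (y ∷ xs))

nth-dropLast : ∀ (τ : List ℕ) j → suc j < length τ → nth (dropLast τ) j ≡ nth τ j
nth-dropLast (x ∷ y ∷ τ) zero _ = refl
nth-dropLast (x ∷ y ∷ τ) (suc j) (s≤s lt) = nth-dropLast (y ∷ τ) j lt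
nth-dropLast (x ∷ []) zero (s≤s ())

<ᵇ-suc-≢ : ∀ z q → z ≢ q → (z <ᵇ suc q) ≡ (z <ᵇ q)
<ᵇ-suc-≢ z q ne with <-cmp z q
... | tri< a _ _ = trans (<⇒<ᵇ-true z (suc q) (<-trans a (n<1+n q))) (sym (<⇒<ᵇ-true z q a))
... | tri≈ _ b _ = ⊥-elim (ne b)
... | tri> _ _ c = trans (≤⇒<ᵇ-false z (suc q) c) (sym (≤⇒<ᵇ-false z q (<⇒≤ c)))

suc-<ᵇ-≢ : ∀ q y → y ≢ suc q → (suc q <ᵇ y) ≡ (q <ᵇ y)
suc-<ᵇ-≢ q y ne with <-cmp (suc q) y
... | tri< a _ _ = trans (<⇒<ᵇ-true (suc q) y a) (sym (<⇒<ᵇ-true q y (<-trans (n<1+n q) a)))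
... | tri≈ _ b _ = ⊥-elim (ne (sym b))
... | tri> _ _ (s≤s c) = trans (≤⇒<ᵇ-false (suc q) y (≤-trans c (n≤1+n q))) (sym (≤⇒<ᵇ-false q y c))

<ᵇ-irrefl : ∀ q → (q <ᵇ q) ≡ false
<ᵇ-irrefl q = ≤⇒<ᵇ-false q q ≤-refl

swapAdj-<ᵇ : ∀ q y z → ¬ (y ≡ q × z ≡ suc q) → ¬ (y ≡ suc q × z ≡ q) → (swapAdj q z <ᵇ swapAdj q y) ≡ (z <ᵇ y)
swapAdj-<ᵇ q y z c1 c2 with ≡ᵇ-cases y q | ≡ᵇ-cases z q
... | inj₁ (_ , refl) | inj₁ (_ , refl) rewrite swapAdj-k y = trans (<ᵇ-irrefl (suc y)) (sym (<ᵇ-irrefl y))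
... | inj₁ (_ , refl) | inj₂ (_ , zq) with ≡ᵇ-cases z (suc y)
...   | inj₁ (_ , e) = ⊥-elim (c1 (refl , e))
...   | inj₂ (_ , zq1) rewrite swapAdj-k y | swapAdj-fix y z zq zq1 = <ᵇ-suc-≢ z y zq
swapAdj-<ᵇ q y z c1 c2 | inj₂ (_ , yq) | inj₁ (_ , refl) with ≡ᵇ-cases y (suc z)
...   | inj₁ (_ , e) = ⊥-elim (c2 (e , refl))
...   | inj₂ (_ , yq1) rewrite swapAdj-k z | swapAdj-fix z y yq yq1 = suc-<ᵇ-≢ z y yq1
swapAdj-<ᵇ q y z c1 c2 | inj₂ (_ , yq) | inj₂ (_ , zq) with ≡ᵇ-cases y (suc q) | ≡ᵇ-cases z (suc q)
... | inj₁ (_ , refl) | inj₁ (_ , refl) rewrite swapAdj-suc q = trans (<ᵇ-irrefl q) (sym (<ᵇ-irrefl (suc q)))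
... | inj₁ (_ , refl) | inj₂ (_ , zq1) rewrite swapAdj-suc q | swapAdj-fix q z zq zq1 = sym (<ᵇ-suc-≢ z q zq)
... | inj₂ (_ , yq1) | inj₁ (_ , refl) rewrite swapAdj-suc q | swapAdj-fix q y yq yq1 = sym (suc-<ᵇ-≢ q y yq1)
... | inj₂ (_ , yq1) | inj₂ (_ , zq1) rewrite swapAdj-fix q z zq zq1 | swapAdj-fix q y yq yq1 = refl

countL-head : ∀ v xs → countL v (v ∷ xs) ≡ suc (countL v xs)
countL-head v xs rewrite ≡ᵇ-refl v = refl

countLess-sAct : ∀ q y xs → (y ≡ q → countL (suc q) xs ≡ 0) → (y ≡ suc q → countL q xs ≡ 0) →
  countLess (swapAdj q y) (sAct q xs) ≡ countLess y xs
countLess-sAct q y [] h1 h2 = refl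
countLess-sAct q y (z ∷ xs) h1 h2 = cong₂ _+_ step (countLess-sAct q y xs h1' h2')
  where
  c1 : ¬ (y ≡ q × z ≡ suc q)
  c1 (refl , refl) = 0≢1+n (trans (sym (h1 refl)) (countL-head (suc q) xs))
  c2 : ¬ (y ≡ suc q × z ≡ q)
  c2 (refl , refl) = 0≢1+n (trans (sym (h2 refl)) (countL-head z xs))
  step : (if swapAdj q z <ᵇ swapAdj q y then 1 else 0) ≡ (if z <ᵇ y then 1 else 0)
  step rewrite swapAdj-<ᵇ q y z c1 c2 = refl
  h1' : y ≡ q → countL (suc q) xs ≡ 0
  h1' e with h1 e
  ... | h with suc q ≡ᵇ z
  ...   | true = ⊥-elim (0≢1+n (sym h))
  ...   | false = h
  h2' : y ≡ suc q → countL q xs ≡ 0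
  h2' e with h2 e
  ... | h with q ≡ᵇ z
  ...   | true = ⊥-elim (0≢1+n (sym h))
  ...   | false = h

countL-∷-≡0 : ∀ v z xs → countL v (z ∷ xs) ≡ 0 → v ≢ z × countL v xs ≡ 0
countL-∷-≡0 v z xs h with ≡ᵇ-cases v z
... | inj₁ (e , refl) = ⊥-elim (0≢1+n (trans (sym h) (countL-head v xs)))
... | inj₂ (e , ne) rewrite e = ne , h

countL-∷-≡1 : ∀ v z xs → countL v (z ∷ xs) ≡ 1 → (v ≡ z × countL v xs ≡ 0) ⊎ (v ≢ z × countL v xs ≡ 1)
countL-∷-≡1 v z xs h with ≡ᵇ-cases v z
... | inj₁ (e , refl) rewrite e = inj₁ (refl , suc-injective h)
... | inj₂ (e , ne) rewrite e = inj₂ (ne , h)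

countLess-sAct-up : ∀ q xs → countL q xs ≡ 0 → countL (suc q) xs ≡ 1 →
  countLess (suc q) (sAct q xs) ≡ suc (countLess q xs)
countLess-sAct-up q [] h0 ()
countLess-sAct-up q (z ∷ xs) h0 h1 with countL-∷-≡0 q z xs h0 | countL-∷-≡1 (suc q) z xs h1
... | (zq , r0) | inj₁ (refl , r1) rewrite swapAdj-suc q | <⇒<ᵇ-true q (suc q) (n<1+n q) | ≤⇒<ᵇ-false (suc q) q (n≤1+n q) =
      cong suc (trans (cong (λ w → countLess w (sAct q xs)) (sym (swapAdj-k q))) (countLess-sAct q q xs (λ _ → r1) (λ e → ⊥-elim (1+n≢n (sym e)))))
... | (zq , r0) | inj₂ (zq1 , r1) rewrite swapAdj-fix q z (λ e → zq (sym e)) (λ e → zq1 (sym e)) | <ᵇ-suc-≢ z q (λ e → zq (sym e)) =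
      trans (cong ((if z <ᵇ q then 1 else 0) +_) (countLess-sAct-up q xs r0 r1)) (+-suc _ _)

countLess-sAct-down : ∀ q xs → countL (suc q) xs ≡ 0 → countL q xs ≡ 1 →
  suc (countLess q (sAct q xs)) ≡ countLess (suc q) xs
countLess-sAct-down q [] h0 ()
countLess-sAct-down q (z ∷ xs) h0 h1 with countL-∷-≡0 (suc q) z xs h0 | countL-∷-≡1 q z xs h1
... | (zq1 , r0) | inj₁ (refl , r1) rewrite swapAdj-k q | ≤⇒<ᵇ-false (suc q) q (n≤1+n q) | <⇒<ᵇ-true q (suc q) (n<1+n q) =
      cong suc (trans (cong (λ w → countLess w (sAct q xs)) (sym (swapAdj-suc q))) (countLess-sAct q (suc q) xs (λ e → ⊥-elim (1+n≢n e)) (λ _ → r1)))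
... | (zq1 , r0) | inj₂ (zq , r1) rewrite swapAdj-fix q z (λ e → zq (sym e)) (λ e → zq1 (sym e)) | <ᵇ-suc-≢ z q (λ e → zq (sym e)) =
      trans (sym (+-suc _ _)) (cong ((if z <ᵇ q then 1 else 0) +_) (countLess-sAct-down q xs r0 r1))

inversions-sAct-absent : ∀ q xs → countL q xs ≡ 0 ⊎ countL (suc q) xs ≡ 0 → inversions (sAct q xs) ≡ inversions xs
inversions-sAct-absent q [] h = refl
inversions-sAct-absent q (z ∷ xs) (inj₁ h) with countL-∷-≡0 q z xs h
... | (zq , r) = cong₂ _+_ (countLess-sAct q z xs (λ e → ⊥-elim (zq (sym e))) (λ _ → r)) (inversions-sAct-absent q xs (inj₁ r))
inversions-sAct-absent q (z ∷ xs) (inj₂ h) with countL-∷-≡0 (suc q) z xs h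
... | (zq , r) = cong₂ _+_ (countLess-sAct q z xs (λ _ → r) (λ e → ⊥-elim (zq (sym e)))) (inversions-sAct-absent q xs (inj₂ r))

inversions-sAct-±1 : ∀ q xs → countL q xs ≡ 1 → countL (suc q) xs ≡ 1 →
  inversions (sAct q xs) ≡ suc (inversions xs) ⊎ suc (inversions (sAct q xs)) ≡ inversions xs
inversions-sAct-±1 q [] ()
inversions-sAct-±1 q (z ∷ xs) h0 h1 with countL-∷-≡1 q z xs h0 | countL-∷-≡1 (suc q) z xs h1
... | inj₁ (refl , r0) | inj₁ (e , _) = ⊥-elim (1+n≢n e)
... | inj₁ (refl , r0) | inj₂ (_ , r1) rewrite swapAdj-k q | inversions-sAct-absent q xs (inj₁ r0) =
  inj₁ (cong (_+ inversions xs) (countLess-sAct-up q xs r0 r1))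
... | inj₂ (_ , r0) | inj₁ (refl , r1) rewrite swapAdj-suc q | inversions-sAct-absent q xs (inj₂ r1) =
  inj₂ (cong (_+ inversions xs) (countLess-sAct-down q xs r1 r0))
... | inj₂ (zq , r0) | inj₂ (zq1 , r1) with inversions-sAct-±1 q xs r0 r1
...   | inj₁ e = inj₁ (trans (cong₂ _+_ cl e) (+-suc _ _))
  where cl = countLess-sAct q z xs (λ e → ⊥-elim (zq (sym e))) (λ e → ⊥-elim (zq1 (sym e)))
...   | inj₂ e = inj₂ (trans (sym (+-suc _ _)) (cong₂ _+_ cl e))
  where cl = countLess-sAct q z xs (λ e → ⊥-elim (zq (sym e))) (λ e → ⊥-elim (zq1 (sym e)))

sgn-sAct : ∀ q xs → countL q xs ≡ 1 → countL (suc q) xs ≡ 1 → sgn (sAct q xs) ≡ - sgn xs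
sgn-sAct q xs h0 h1 with inversions-sAct-±1 q xs h0 h1
... | inj₁ e rewrite e = refl
... | inj₂ e rewrite sym e = sym (ℤP.neg-involutive _)

countLess-snoc-≥ : ∀ y xs m → y ≤ m → countLess y (xs ++ [ m ]) ≡ countLess y xs
countLess-snoc-≥ y [] m le rewrite ≤⇒<ᵇ-false m y le = refl
countLess-snoc-≥ y (z ∷ xs) m le = cong ((if z <ᵇ y then 1 else 0) +_) (countLess-snoc-≥ y xs m le)

inversions-snoc-max : ∀ xs m → All (_≤ m) xs → inversions (xs ++ [ m ]) ≡ inversions xs
inversions-snoc-max [] m _ = refl
inversions-snoc-max (z ∷ xs) m (p ∷ ps) = cong₂ _+_ (countLess-snoc-≥ z xs m p) (inversions-snoc-max xs m ps)

sgn-snoc-max : ∀ xs m → All (_≤ m) xs → sgn (xs ++ [ m ]) ≡ sgn xs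
sgn-snoc-max xs m h = cong negOnePow (inversions-snoc-max xs m h)

countL-↭ : ∀ v {xs ys} → xs ↭ ys → countL v xs ≡ countL v ys
countL-↭ v Perm.refl = refl
countL-↭ v (Perm.prep x p) = cong ((if v ≡ᵇ x then 1 else 0) +_) (countL-↭ v p)
countL-↭ v (Perm.swap x y p) = trans (x∙yz≈y∙xz (if v ≡ᵇ x then 1 else 0) (if v ≡ᵇ y then 1 else 0) _)
   (cong (λ w → (if v ≡ᵇ y then 1 else 0) + ((if v ≡ᵇ x then 1 else 0) + w)) (countL-↭ v p))
countL-↭ v (Perm.trans p q) = trans (countL-↭ v p) (countL-↭ v q)

countL-snoc : ∀ v xs a → countL v (xs ++ [ a ]) ≡ countL v xs + (if v ≡ᵇ a then 1 else 0)
countL-snoc v [] a = +-identityʳ _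
countL-snoc v (z ∷ xs) a = trans (cong ((if v ≡ᵇ z then 1 else 0) +_) (countL-snoc v xs a)) (sym (+-assoc (if v ≡ᵇ z then 1 else 0) _ _))

identityPerm : ℕ → List ℕ
identityPerm n = map suc (upTo n)

identityPerm-suc : ∀ n → identityPerm (suc n) ≡ identityPerm n ++ [ suc n ]
identityPerm-suc n = trans (cong (map suc) (sym (LP.upTo-∷ʳ n))) (LP.map-++ suc (upTo n) [ n ])

countL-identityPerm-out : ∀ n v → v ≡ 0 ⊎ n < v → countL v (identityPerm n) ≡ 0
countL-identityPerm-out zero v h = refl
countL-identityPerm-out (suc n) v h =
  trans (cong (countL v) (identityPerm-suc n)) (trans (countL-snoc v (identityPerm n) (suc n))
    (cong₂ _+_ (countL-identityPerm-out n v (h' h)) (cong (λ b → if b then 1 else 0) (≢⇒≡ᵇ-false v (suc n) (ne h)))))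
  where
  h' : v ≡ 0 ⊎ suc n < v → v ≡ 0 ⊎ n < v
  h' (inj₁ e) = inj₁ e
  h' (inj₂ lt) = inj₂ (<-trans (n<1+n n) lt)
  ne : v ≡ 0 ⊎ suc n < v → v ≢ suc n
  ne (inj₁ e0) e = 0≢1+n (trans (sym e0) e)
  ne (inj₂ lt) e = <-irrefl (sym e) lt

countL-identityPerm-in : ∀ n v → 1 ≤ v → v ≤ n → countL v (identityPerm n) ≡ 1
countL-identityPerm-in zero v a b = ⊥-elim (<-irrefl refl (≤-trans a b))
countL-identityPerm-in (suc n) v a b = trans (cong (countL v) (identityPerm-suc n)) (trans (countL-snoc v (identityPerm n) (suc n)) (go (≡ᵇ-cases v (suc n))))
  where
  go : (v ≡ᵇ suc n) ≡ true × v ≡ suc n ⊎ (v ≡ᵇ suc n) ≡ false × v ≢ suc n →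
       countL v (identityPerm n) + (if v ≡ᵇ suc n then 1 else 0) ≡ 1
  go (inj₁ (e , refl)) rewrite e = cong (_+ 1) (countL-identityPerm-out n (suc n) (inj₂ ≤-refl))
  go (inj₂ (e , ne)) rewrite e = trans (+-identityʳ _) (countL-identityPerm-in n v a (≤-pred (≤∧≢⇒< b ne)))

countL-nth-pos : ∀ xs j → j < length xs → 1 ≤ countL (nth xs j) xs
countL-nth-pos (x ∷ xs) zero _ rewrite ≡ᵇ-refl x = s≤s z≤n
countL-nth-pos (x ∷ xs) (suc j) (s≤s lt) = ≤-trans (countL-nth-pos xs j lt) (m≤n+m _ _)

countL-nth-repeated : ∀ xs i j → i < j → j < length xs → nth xs i ≡ nth xs j → 2 ≤ countL (nth xs i) xs
countL-nth-repeated (x ∷ xs) zero (suc j) _ (s≤s lt) e rewrite ≡ᵇ-refl x = s≤s (subst (λ w → 1 ≤ countL w xs) (sym e) (countL-nth-pos xs j lt))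
countL-nth-repeated (x ∷ xs) (suc i) (suc j) (s≤s ij) (s≤s lt) e = ≤-trans (countL-nth-repeated xs i j ij lt e) (m≤n+m _ _)

countL-pos⇒nth : ∀ v xs → 1 ≤ countL v xs → ∃[ j ] (j < length xs × nth xs j ≡ v)
countL-pos⇒nth v [] ()
countL-pos⇒nth v (x ∷ xs) h with ≡ᵇ-cases v x
... | inj₁ (_ , e) = 0 , s≤s z≤n , sym e
... | inj₂ (e , _) rewrite e with countL-pos⇒nth v xs h
...   | (j , lt , eq) = suc j , s≤s lt , eq

module IsPermProperties (σ : List ℕ) (P : IsPerm σ) where
  ℓ : ℕ
  ℓ = length σ
  countL-identityPerm : ∀ v → countL v σ ≡ countL v (identityPerm ℓ)
  countL-identityPerm v = countL-↭ v P

  countL-≡1 : ∀ v → 1 ≤ v → v ≤ ℓ → countL v σ ≡ 1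
  countL-≡1 v a b = trans (countL-identityPerm v) (countL-identityPerm-in ℓ v a b)

  nth-bounds : ∀ j → j < ℓ → 1 ≤ nth σ j × nth σ j ≤ ℓ
  nth-bounds j lt with nth σ j ≟ 0 | ℓ <? nth σ j
  ... | yes e | _ = ⊥-elim (<-irrefl refl (≤-trans (countL-nth-pos σ j lt) (≤-reflexive (trans (countL-identityPerm (nth σ j)) (countL-identityPerm-out ℓ _ (inj₁ e))))))
  ... | no _ | yes gt = ⊥-elim (<-irrefl refl (≤-trans (countL-nth-pos σ j lt) (≤-reflexive (trans (countL-identityPerm (nth σ j)) (countL-identityPerm-out ℓ _ (inj₂ gt))))))
  ... | no ne | no ng = n≢0⇒n>0 ne , ≮⇒≥ ng

  nth-<-≢ : ∀ i j → i < j → j < ℓ → nth σ i ≢ nth σ j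
  nth-<-≢ i j ij lt e with nth-bounds j lt
  ... | (a , b) = <-irrefl refl (≤-trans (countL-nth-repeated σ i j ij lt e) (≤-reflexive (trans (cong (λ w → countL w σ) e) (countL-≡1 _ a b))))

  nth-injective : ∀ i j → i < ℓ → j < ℓ → nth σ i ≡ nth σ j → i ≡ j
  nth-injective i j il jl e with <-cmp i j
  ... | tri< a _ _ = ⊥-elim (nth-<-≢ i j a jl e)
  ... | tri≈ _ b _ = b
  ... | tri> _ _ c = ⊥-elim (nth-<-≢ j i c il (sym e))

  nth-surjective : ∀ v → 1 ≤ v → v ≤ ℓ → ∃[ j ] (j < ℓ × nth σ j ≡ v)
  nth-surjective v a b = countL-pos⇒nth v σ (≤-reflexive (sym (countL-≡1 v a b)))

∧-true : ∀ {a b} → a ∧ b ≡ true → a ≡ true × b ≡ true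
∧-true {true} {true} _ = refl , refl

∨-false : ∀ {a b} → a ∨ b ≡ false → a ≡ false × b ≡ false
∨-false {false} {false} _ = refl , refl

all-true : ∀ {A : Set} (p : A → Bool) xs → all p xs ≡ true → All (λ e → p e ≡ true) xs
all-true p [] _ = []
all-true p (x ∷ xs) h with ∧-true {p x} h
... | (a , b) = a ∷ all-true p xs b

all-true⁻ : ∀ {A : Set} (p : A → Bool) xs → All (λ e → p e ≡ true) xs → all p xs ≡ true
all-true⁻ p [] _ = refl
all-true⁻ p (x ∷ xs) (a ∷ h) rewrite a = all-true⁻ p xs h

any-false : ∀ {A : Set} (p : A → Bool) xs → any p xs ≡ false → All (λ e → p e ≡ false) xs
any-false p [] _ = []
any-false p (x ∷ xs) h with ∨-false {p x} h
... | (a , b) = a ∷ any-false p xs b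

any-false⁻ : ∀ {A : Set} (p : A → Bool) xs → All (λ e → p e ≡ false) xs → any p xs ≡ false
any-false⁻ p [] _ = refl
any-false⁻ p (x ∷ xs) (a ∷ h) rewrite a = any-false⁻ p xs h

any-true : ∀ {A : Set} (p : A → Bool) xs → any p xs ≡ true → Any (λ e → p e ≡ true) xs
any-true p [] ()
any-true p (x ∷ xs) h with p x in eq
... | true = here eq
... | false = there (any-true p xs h)

any-true⁻ : ∀ {A : Set} (p : A → Bool) xs → Any (λ e → p e ≡ true) xs → any p xs ≡ true
any-true⁻ p (x ∷ xs) (here e) rewrite e = refl
any-true⁻ p (x ∷ xs) (there h) rewrite any-true⁻ p xs h with p x
... | true = refl
... | false = refl

false≢true : false ≢ true
false≢true ()

bool-split : ∀ (b : Bool) → b ≡ true ⊎ b ≡ false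
bool-split true = inj₁ refl
bool-split false = inj₂ refl

-- Conditions (a)–(c) of step (1) for row c + 1 (rows are 0-based here);
-- e + ℓ ≡ M + i encodes e = M − ℓ + i without truncated subtraction.
Settled : ℕ → ℕ → List ℕ → Tableau → ℕ → Set
Settled ℓ M σ S c = nth σ c ≡ suc c × All (λ e → e + ℓ ≡ M + suc c) (rowAt S c) ×
  (∀ j → j ≢ c → All (λ e → e + ℓ ≢ M + suc c) (rowAt S j))

module PsiSpec (σ : List ℕ) (S : Tableau) where
  open PsiAux σ S

  isVal-true : ∀ i e → isVal i e ≡ true → e + ℓ ≡ M + i
  isVal-true i e h = ≡ᵇ-true⇒≡ _ _ h

  isVal-true⁻ : ∀ i e → e + ℓ ≡ M + i → isVal i e ≡ true
  isVal-true⁻ i e h rewrite h = ≡ᵇ-refl (M + i)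

  isVal-false : ∀ i e → isVal i e ≡ false → e + ℓ ≢ M + i
  isVal-false i e h = ≡ᵇ-false⇒≢ _ _ h

  isVal-false⁻ : ∀ i e → e + ℓ ≢ M + i → isVal i e ≡ false
  isVal-false⁻ i e h = ≢⇒≡ᵇ-false _ _ h

  occursElsewhere-false : ∀ i j T → occursElsewhere i j T ≡ false → ∀ m → j + m ≢ i → All (λ e → isVal i e ≡ false) (rowAt T m)
  occursElsewhere-false i j [] h m ne = []
  occursElsewhere-false i j (r ∷ T) h zero ne with ∨-false {(not (j ≡ᵇ i)) ∧ any (isVal i) r} h
  ... | (a , b) rewrite ≢⇒≡ᵇ-false j i (λ e → ne (trans (+-identityʳ j) e)) = any-false (isVal i) r a
  occursElsewhere-false i j (r ∷ T) h (suc m) ne with ∨-false {(not (j ≡ᵇ i)) ∧ any (isVal i) r} h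
  ... | (a , b) = occursElsewhere-false i (suc j) T b m (λ e → ne (trans (+-suc j m) e))

  occursElsewhere-false⁻ : ∀ i j T → (∀ m → j + m ≢ i → All (λ e → isVal i e ≡ false) (rowAt T m)) → occursElsewhere i j T ≡ false
  occursElsewhere-false⁻ i j [] h = refl
  occursElsewhere-false⁻ i j (r ∷ T) h rewrite occursElsewhere-false⁻ i (suc j) T (λ m ne → h (suc m) (λ e → ne (trans (sym (+-suc j m)) e))) with ≡ᵇ-cases j i
  ... | inj₁ (e , _) rewrite e = refl
  ... | inj₂ (e , ne) rewrite e | any-false⁻ (isVal i) r (h 0 (λ e → ne (trans (sym (+-identityʳ j)) e))) = refl

  good⇒Settled : ∀ c → good (suc c) ≡ true → Settled ℓ M σ S c
  good⇒Settled c h with ∧-true {nth σ c ≡ᵇ suc c} h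
  ... | (a , b) with ∧-true {all (isVal (suc c)) (rowAt S c)} b
  ...   | (b1 , b2) = ≡ᵇ-true⇒≡ _ _ a , All.map (isVal-true (suc c) _) (all-true _ _ b1) ,
          λ j ne → All.map (isVal-false (suc c) _) (occursElsewhere-false (suc c) 1 S (not-true b2) j (λ e → ne (suc-injective e)))
    where
    not-true : ∀ {b} → not b ≡ true → b ≡ false
    not-true {false} _ = refl

  Settled⇒good : ∀ c → Settled ℓ M σ S c → good (suc c) ≡ true
  Settled⇒good c (a , b , d)
    rewrite subst (λ z → (nth σ c ≡ᵇ z) ≡ true) a (≡ᵇ-refl (nth σ c))
          | all-true⁻ (isVal (suc c)) (rowAt S c) (All.map (isVal-true⁻ (suc c) _) b)
          | occursElsewhere-false⁻ (suc c) 1 S (λ m ne → All.map (isVal-false⁻ (suc c) _) (d m (λ e → ne (cong suc e)))) = refl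

  good-false⇒¬Settled : ∀ c → good (suc c) ≡ false → ¬ Settled ℓ M σ S c
  good-false⇒¬Settled c h g = false≢true (trans (sym h) (Settled⇒good c g))

  ¬Settled⇒good-false : ∀ c → ¬ Settled ℓ M σ S c → good (suc c) ≡ false
  ¬Settled⇒good-false c ng with bool-split (good (suc c))
  ... | inj₁ t = ⊥-elim (ng (good⇒Settled c t))
  ... | inj₂ f = f

  kFrom-spec : ∀ m → kFrom m ≤ m × (∀ c → kFrom m ≤ c → c < m → good (suc c) ≡ true) ×
    (kFrom m ≡ 0 ⊎ ∃[ c ] (kFrom m ≡ suc c × good (suc c) ≡ false))
  kFrom-spec zero = z≤n , (λ c _ ()) , inj₁ refl
  kFrom-spec (suc m) with good (suc m) in eq
  ... | true with kFrom-spec m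
  ...   | (a , b , d) = ≤-trans a (n≤1+n m) , (λ c le lt → case≤ c le lt) , d
    where
    case≤ : ∀ c → kFrom m ≤ c → c < suc m → good (suc c) ≡ true
    case≤ c le lt with m≤n⇒m<n∨m≡n (≤-pred lt)
    ... | inj₁ l = b c le l
    ... | inj₂ refl = eq
  kFrom-spec (suc m) | false = ≤-refl , (λ c le lt → ⊥-elim (<-irrefl refl (≤-trans lt le))) , inj₂ (m , refl , eq)

  kFrom-unique : ∀ m k0 → k0 ≤ m → (∀ c → k0 ≤ c → c < m → good (suc c) ≡ true) →
    (k0 ≡ 0 ⊎ ∃[ c ] (k0 ≡ suc c × good (suc c) ≡ false)) → kFrom m ≡ k0
  kFrom-unique zero .zero z≤n _ _ = refl
  kFrom-unique (suc m) k0 le tl hd with m≤n⇒m<n∨m≡n le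
  ... | inj₁ lt rewrite tl m (≤-pred lt) ≤-refl = kFrom-unique m k0 (≤-pred lt) (λ c a b → tl c a (≤-trans b (n≤1+n m))) hd
  ... | inj₂ refl with hd
  ...   | inj₁ ()
  ...   | inj₂ (c , refl , g) rewrite g = refl

  containsX : List ℕ → Bool
  containsX row = any (isVal k) row

  MinimalAt : List ℕ → Tableau → ℕ → Set
  MinimalAt ss rows q = ∀ i → i < length ss → containsX (rowAt rows i) ≡ true → q ≤ nth ss i

  FoundIn : ℕ → List ℕ → Tableau → ℕ → ℕ → Set
  FoundIn j ss rows r q = ∃[ i ] (r ≡ j + i × i < length rows × containsX (rowAt rows i) ≡ true × nth ss i ≡ q)

  Origin : ℕ → List ℕ → Tableau → Maybe (ℕ × ℕ) → ℕ → ℕ → Set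
  Origin j ss rows acc r q = acc ≡ just (r , q) ⊎ FoundIn j ss rows r q

  AccMinimal : Maybe (ℕ × ℕ) → ℕ → Set
  AccMinimal acc q = ∀ a b → acc ≡ just (a , b) → q ≤ b

  found-there : ∀ {j s ss row rows r q} → FoundIn (suc j) ss rows r q → FoundIn j (s ∷ ss) (row ∷ rows) r q
  found-there {j} (i , e1 , e2 , e3 , e4) = suc i , trans e1 (sym (+-suc j i)) , s≤s e2 , e3 , e4

  origin-there : ∀ {j s ss row rows acc r q} → Origin (suc j) ss rows acc r q → Origin j (s ∷ ss) (row ∷ rows) acc r q
  origin-there (inj₁ e) = inj₁ e
  origin-there (inj₂ f) = inj₂ (found-there f)

  origin-here : ∀ {j s ss row rows acc r q} → containsX row ≡ true →
    Origin (suc j) ss rows (just (j , s)) r q → Origin j (s ∷ ss) (row ∷ rows) acc r q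
  origin-here {j} h (inj₁ refl) = inj₂ (0 , sym (+-identityʳ j) , s≤s z≤n , h , refl)
  origin-here h (inj₂ f) = inj₂ (found-there f)

  minimal-∷ : ∀ {s ss row rows q} → (containsX row ≡ true → q ≤ s) → MinimalAt ss rows q → MinimalAt (s ∷ ss) (row ∷ rows) q
  minimal-∷ h m zero _ b = h b
  minimal-∷ h m (suc i) (s≤s lt) b = m i lt b

  best-just : ∀ j ss rows acc r q → best j ss rows acc ≡ just (r , q) →
    Origin j ss rows acc r q × MinimalAt ss rows q × AccMinimal acc q
  best-just j [] rows acc r q h = inj₁ h , (λ i ()) , λ a b e → ≤-reflexive (cong proj₂ (just-injective (trans (sym h) e)))
  best-just j (s ∷ ss) [] acc r q h = inj₁ h , (λ { zero _ () ; (suc i) _ () }) , λ a b e → ≤-reflexive (cong proj₂ (just-injective (trans (sym h) e)))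
  best-just j (s ∷ ss) (row ∷ rows) acc r q h with any (isVal k) row in eq
  ... | false with best-just (suc j) ss rows acc r q h
  ...   | (o , m , a) = origin-there o , minimal-∷ (λ b → ⊥-elim (false≢true (trans (sym eq) b))) m , a
  best-just j (s ∷ ss) (row ∷ rows) nothing r q h | true with best-just (suc j) ss rows (just (j , s)) r q h
  ...   | (o , m , a) = origin-here eq o , minimal-∷ (λ _ → a j s refl) m , (λ _ _ ())
  best-just j (s ∷ ss) (row ∷ rows) (just (j' , s')) r q h | true with s <ᵇ s' in lt | best-just (suc j) ss rows (if s <ᵇ s' then just (j , s) else just (j' , s')) r q h
  ...   | true | (o , m , a) = origin-here eq o , minimal-∷ (λ _ → a j s refl) m ,
                               λ { _ _ refl → ≤-trans (a j s refl) (<⇒≤ (<ᵇ-true⇒< s s' lt)) }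
  ...   | false | (o , m , a) = origin-there o , minimal-∷ (λ _ → ≤-trans (a j' s' refl) (≮⇒≥ (λ l → false≢true (trans (sym lt) (<⇒<ᵇ-true s s' l))))) m , a

  best-never : ∀ j ss rows a → best j ss rows (just a) ≢ nothing
  best-never j [] rows a ()
  best-never j (s ∷ ss) [] a ()
  best-never j (s ∷ ss) (row ∷ rows) (j' , s') h with any (isVal k) row
  ... | false = best-never (suc j) ss rows (j' , s') h
  ... | true with s <ᵇ s'
  ...   | true = best-never (suc j) ss rows (j , s) h
  ...   | false = best-never (suc j) ss rows (j' , s') h

  best-nothing : ∀ j ss rows → best j ss rows nothing ≡ nothing → length ss ≡ length rows →
    ∀ i → containsX (rowAt rows i) ≡ false
  best-nothing j [] [] h l i = refl
  best-nothing j (s ∷ ss) (row ∷ rows) h l i with any (isVal k) row in eq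
  best-nothing j (s ∷ ss) (row ∷ rows) h l zero | false = eq
  best-nothing j (s ∷ ss) (row ∷ rows) h l (suc i) | false = best-nothing (suc j) ss rows h (suc-injective l) i
  best-nothing j (s ∷ ss) (row ∷ rows) h l i | true = ⊥-elim (best-never (suc j) ss rows (j , s) h)

  best-exists : length σ ≡ length S → (∃[ i ] containsX (rowAt S i) ≡ true) →
    ∃[ r0 ] ∃[ q ] (best 1 σ S nothing ≡ just (suc r0 , q) × r0 < length S × containsX (rowAt S r0) ≡ true × nth σ r0 ≡ q × MinimalAt σ S q)
  best-exists l (i0 , bi) with best 1 σ S nothing in eq
  ... | nothing = ⊥-elim (false≢true (trans (sym (best-nothing 1 σ S eq l i0)) bi))
  ... | just (r , q) with best-just 1 σ S nothing r q eq
  ...   | (inj₁ () , _)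
  ...   | (inj₂ (i , refl , lt , b , e) , m , _) = i , q , refl , lt , b , e , m

foldr-⊔-ub : ∀ e xs → e ∈ xs → e ≤ foldr _⊔_ 0 xs
foldr-⊔-ub e (x ∷ xs) (here refl) = m≤m⊔n x _
foldr-⊔-ub e (x ∷ xs) (there h) = ≤-trans (foldr-⊔-ub e xs h) (m≤n⊔m x _)

foldr-⊔-lub : ∀ m xs → All (_≤ m) xs → foldr _⊔_ 0 xs ≤ m
foldr-⊔-lub m [] _ = z≤n
foldr-⊔-lub m (x ∷ xs) (p ∷ ps) = ⊔-lub p (foldr-⊔-lub m xs ps)

foldr-⊔-∈ : ∀ x xs → foldr _⊔_ 0 (x ∷ xs) ∈ (x ∷ xs)
foldr-⊔-∈ x [] = here (m≥n⇒m⊔n≡m z≤n)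
foldr-⊔-∈ x (y ∷ xs) with ⊔-sel x (foldr _⊔_ 0 (y ∷ xs))
... | inj₁ e = here e
... | inj₂ e = there (subst (_∈ (y ∷ xs)) (sym e) (foldr-⊔-∈ y xs))

∈-concat⁺ : ∀ (S : Tableau) j e → e ∈ rowAt S j → e ∈ concat S
∈-concat⁺ (r ∷ S) zero e h = ∈-++⁺ˡ h
∈-concat⁺ (r ∷ S) (suc j) e h = ∈-++⁺ʳ r (∈-concat⁺ S j e h)

∈-concat⁻ : ∀ (S : Tableau) e → e ∈ concat S → ∃[ j ] (j < length S × e ∈ rowAt S j)
∈-concat⁻ (r ∷ S) e h with ∈-++⁻ r h
... | inj₁ a = 0 , s≤s z≤n , a
... | inj₂ b with ∈-concat⁻ S e b
...   | (j , lt , m) = suc j , s≤s lt , m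

All-concat⁺ : ∀ {P : ℕ → Set} (S : Tableau) → (∀ j → All P (rowAt S j)) → All P (concat S)
All-concat⁺ [] h = []
All-concat⁺ (r ∷ S) h = AllP.++⁺ (h 0) (All-concat⁺ S (λ j → h (suc j)))

maxEntry-ub : ∀ (S : Tableau) j e → e ∈ rowAt S j → e ≤ maxEntry S
maxEntry-ub S j e h = foldr-⊔-ub e (concat S) (∈-concat⁺ S j e h)

maxEntry-≡ : ∀ (S : Tableau) m → (∀ j → All (_≤ m) (rowAt S j)) → (∃[ j ] m ∈ rowAt S j) → maxEntry S ≡ m
maxEntry-≡ S m h (j , mem) = ≤-antisym (foldr-⊔-lub m (concat S) (All-concat⁺ S h)) (maxEntry-ub S j m mem)

maxEntry-∈ : ∀ (S : Tableau) j e → e ∈ rowAt S j → ∃[ j' ] (j' < length S × maxEntry S ∈ rowAt S j')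
maxEntry-∈ S j e h with concat S in eq
... | [] with () ← subst (e ∈_) eq (∈-concat⁺ S j e h)
... | x ∷ xs = ∈-concat⁻ S _ (subst (_ ∈_) (sym eq) (foldr-⊔-∈ x xs))

ψ-k≡suc : ∀ σ S k0 → PsiAux.k σ S ≡ suc k0 →
  ψ σ S ≡ PsiAux.stepR σ S (PsiAux.best σ S 1 σ S nothing)
ψ-k≡suc σ S k0 eq with PsiAux.k σ S | eq
... | .(suc k0) | refl = refl

ψ-k≡0 : ∀ σ S → PsiAux.k σ S ≡ 0 → ψ σ S ≡ (σ , S)
ψ-k≡0 σ S eq with PsiAux.k σ S | eq
... | .0 | refl = refl

hd : List ℕ → ℕ
hd [] = 0
hd (x ∷ _) = x

All-rowAt : ∀ {P : List ℕ → Set} (S : Tableau) → All P S → ∀ j → j < length S → P (rowAt S j)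
All-rowAt (r ∷ S) (p ∷ ps) zero _ = p
All-rowAt (r ∷ S) (p ∷ ps) (suc j) (s≤s lt) = All-rowAt S ps j lt

linked-head-≤ : ∀ a xs → Linked _≤_ (a ∷ xs) → All (a ≤_) (a ∷ xs)
linked-head-≤ a [] _ = ≤-refl ∷ []
linked-head-≤ a (b ∷ xs) (p ∷ l) with linked-head-≤ b xs l
... | q ∷ qs = ≤-refl ∷ All.map (≤-trans p) (q ∷ qs)

linked-dropLast-max : ∀ (row : List ℕ) x → Linked _≤_ row → x ∈ row → All (_≤ x) row → dropLast row ++ [ x ] ≡ row
linked-dropLast-max (a ∷ []) x _ (here refl) _ = refl
linked-dropLast-max (a ∷ []) x _ (there ()) _
linked-dropLast-max (a ∷ b ∷ row) x (p ∷ l) m (_ ∷ ps) = cong (a ∷_) (linked-dropLast-max (b ∷ row) x l (m' m ps) ps)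
  where
  m' : x ∈ (a ∷ b ∷ row) → All (_≤ x) (b ∷ row) → x ∈ (b ∷ row)
  m' (there t) _ = t
  m' (here refl) (q ∷ _) = here (≤-antisym p q)

record ImmaculateFacts (S : Tableau) : Set where
  field
    nonempty : ∀ j → j < length S → 1 ≤ length (rowAt S j)
    hd-mem : ∀ j → j < length S → hd (rowAt S j) ∈ rowAt S j
    hd-lt : ∀ i j → i < j → j < length S → hd (rowAt S i) < hd (rowAt S j)
    entries-ge : ∀ j → All (suc j ≤_) (rowAt S j)
    row-last : ∀ j x → x ∈ rowAt S j → All (_≤ x) (rowAt S j) → dropLast (rowAt S j) ++ [ x ] ≡ rowAt S j

firstCol-nonEmpty : ∀ (S : Tableau) → All NonEmpty S → firstCol S ≡ map hd S
firstCol-nonEmpty [] _ = refl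
firstCol-nonEmpty ((x ∷ r) ∷ S) (_ ∷ ps) = cong (x ∷_) (firstCol-nonEmpty S ps)

hd-<-suc : ∀ (S : Tableau) → Linked _<_ (map hd S) → ∀ j → suc j < length S → hd (rowAt S j) < hd (rowAt S (suc j))
hd-<-suc (r ∷ r' ∷ S) (p ∷ l) zero _ = p
hd-<-suc (r ∷ r' ∷ S) (p ∷ l) (suc j) (s≤s lt) = hd-<-suc (r' ∷ S) l j lt
hd-<-suc (r ∷ []) _ zero (s≤s ())

hd-strictMono : ∀ (S : Tableau) → (∀ j → suc j < length S → hd (rowAt S j) < hd (rowAt S (suc j))) →
  ∀ i j → i < j → j < length S → hd (rowAt S i) < hd (rowAt S j)
hd-strictMono S h i (suc j) (s≤s le) lt with m≤n⇒m<n∨m≡n le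
... | inj₁ l = <-trans (hd-strictMono S h i j l (<-trans (n<1+n j) lt)) (h j lt)
... | inj₂ refl = h i lt

hd-∈ : ∀ (row : List ℕ) → 1 ≤ length row → hd row ∈ row
hd-∈ (x ∷ row) _ = here refl

hd-≤ : ∀ (row : List ℕ) → Linked _≤_ row → All (hd row ≤_) row
hd-≤ [] _ = []
hd-≤ (a ∷ row) l = linked-head-≤ a row l

immaculateFacts : ∀ S → IsImmaculate S → ImmaculateFacts S
immaculateFacts S (ne , positive , srt , fc) = record
  { nonempty = ne'
  ; hd-mem = λ j lt → hd-∈ (rowAt S j) (ne' j lt)
  ; hd-lt = hlt
  ; entries-ge = eg
  ; row-last = λ j x m a → linked-dropLast-max (rowAt S j) x (srt' j) m a
  }
  where
  ne' : ∀ j → j < length S → 1 ≤ length (rowAt S j)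
  ne' = All-rowAt S ne
  srt' : ∀ j → Linked _≤_ (rowAt S j)
  srt' j with j <? length S
  ... | yes lt = All-rowAt S srt j lt
  ... | no nlt rewrite rowAt-beyond S j (≮⇒≥ nlt) = []
  hlt : ∀ i j → i < j → j < length S → hd (rowAt S i) < hd (rowAt S j)
  hlt = hd-strictMono S (hd-<-suc S (subst (Linked _<_) (firstCol-nonEmpty S ne) fc))
  hge : ∀ j → j < length S → suc j ≤ hd (rowAt S j)
  hge zero lt with All-rowAt S positive 0 lt | ne' 0 lt
  ... | p | l with rowAt S 0
  ...   | x ∷ _ with p
  ...     | q ∷ _ = q
  hge (suc j) lt = ≤-trans (s≤s (hge j (<-trans (n<1+n j) lt))) (hd-<-suc S (subst (Linked _<_) (firstCol-nonEmpty S ne) fc) j lt)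
  eg : ∀ j → All (suc j ≤_) (rowAt S j)
  eg j with j <? length S
  ... | yes lt = All.map (≤-trans (hge j lt)) (hd-≤ (rowAt S j) (srt' j))
  ... | no nlt rewrite rowAt-beyond S j (≮⇒≥ nlt) = []

∈⇒countL-pos : ∀ v row → v ∈ row → 1 ≤ countL v row
∈⇒countL-pos v (x ∷ row) (here refl) rewrite ≡ᵇ-refl v = s≤s z≤n
∈⇒countL-pos v (x ∷ row) (there h) = ≤-trans (∈⇒countL-pos v row h) (m≤n+m _ _)

countL-pos⇒∈ : ∀ v row → 1 ≤ countL v row → v ∈ row
countL-pos⇒∈ v [] ()
countL-pos⇒∈ v (x ∷ row) h with ≡ᵇ-cases v x
... | inj₁ (_ , e) = here e
... | inj₂ (e , _) rewrite e = there (countL-pos⇒∈ v row h)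

∈⇒countT-pos : ∀ v (S : Tableau) j → v ∈ rowAt S j → 1 ≤ countT v S
∈⇒countT-pos v (r ∷ S) zero h = ≤-trans (∈⇒countL-pos v r h) (m≤m+n _ _)
∈⇒countT-pos v (r ∷ S) (suc j) h = ≤-trans (∈⇒countT-pos v S j h) (m≤n+m _ _)

countT-pos⇒∈ : ∀ v (S : Tableau) → 1 ≤ countT v S → ∃[ j ] (j < length S × v ∈ rowAt S j)
countT-pos⇒∈ v [] ()
countT-pos⇒∈ v (r ∷ S) h with countL v r ≟ 0
... | no ne = 0 , s≤s z≤n , countL-pos⇒∈ v r (n≢0⇒n>0 ne)
... | yes e with countT-pos⇒∈ v S (subst (1 ≤_) (cong (_+ countT v S) e) h)
...   | (j , lt , m) = suc j , s≤s lt , m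

nth-beyond : ∀ xs j → length xs ≤ j → nth xs j ≡ 0
nth-beyond [] j _ = refl
nth-beyond (x ∷ xs) (suc j) (s≤s le) = nth-beyond xs j le

All-nth : ∀ {P : ℕ → Set} xs j → All P xs → j < length xs → P (nth xs j)
All-nth (x ∷ xs) zero (p ∷ _) _ = p
All-nth (x ∷ xs) (suc j) (_ ∷ ps) (s≤s lt) = All-nth xs j ps lt

values-occur : ∀ (S : Tableau) β → HasContentT S β → All (1 ≤_) β → ImmaculateFacts S →
  ∀ j0 e0 → e0 ∈ rowAt S j0 →
  ∀ v → 1 ≤ v → v ≤ maxEntry S → ∃[ j ] (j < length S × v ∈ rowAt S j)
values-occur S β C positive I j0 e0 m0 v v1 vM with maxEntry-∈ S j0 e0 m0
... | (j1 , lt1 , mM) = countT-pos⇒∈ v S cv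
  where
  open ImmaculateFacts I
  M1 : 1 ≤ maxEntry S
  M1 = ≤-trans (s≤s z≤n) (All.lookup (entries-ge j1) mM)
  pm : ℕ
  pm = pred (maxEntry S)
  sm : suc pm ≡ maxEntry S
  sm = suc-pred (maxEntry S) {{>-nonZero M1}}
  cM : 1 ≤ nth β pm
  cM = subst (1 ≤_) (C pm) (subst (λ w → 1 ≤ countT w S) (sym sm) (∈⇒countT-pos _ S j1 mM))
  ltM : pm < length β
  ltM with pm <? length β
  ... | yes l = l
  ... | no nl = ⊥-elim (<-irrefl refl (≤-trans cM (≤-reflexive (nth-beyond β pm (≮⇒≥ nl)))))
  pv : ℕ
  pv = pred v
  sv : suc pv ≡ v
  sv = suc-pred v {{>-nonZero v1}}
  ltv : pv < length β
  ltv = ≤-<-trans (≤-pred (subst₂ _≤_ (sym sv) (sym sm) vM)) ltM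
  cv : 1 ≤ countT v S
  cv = subst (λ w → 1 ≤ countT w S) sv (subst (1 ≤_) (sym (C pv)) (All-nth β pv positive ltv))

fl-all : ∀ {Q : ℤ → Set} D → All Q (fl D) → All (λ z → z ≡ 0ℤ ⊎ Q z) D
fl-all [] _ = []
fl-all (z ∷ D) h with z ℤ.≟ 0ℤ
... | yes e = inj₁ e ∷ fl-all D h
... | no _ with h
...   | q ∷ qs = inj₂ q ∷ fl-all D qs

map-pos-nonneg : ∀ α → All (λ z → ∃[ a ] z ≡ pos a) (map pos α)
map-pos-nonneg [] = []
map-pos-nonneg (a ∷ α) = (a , refl) ∷ map-pos-nonneg α

delta-at : ∀ {P : ℤ → Set} i γ σ → All P (deltaFrom i γ σ) → ∀ j → j < length γ → j < length σ →
  P ((pos (nth γ j) ℤ.+ pos (nth σ j)) ℤ.- pos (i + j))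
delta-at i (g ∷ γ) (s ∷ σ) (p ∷ _) zero _ _ rewrite +-identityʳ i = p
delta-at {P} i (g ∷ γ) (s ∷ σ) (_ ∷ ps) (suc j) (s≤s l1) (s≤s l2) =
  subst (λ w → P ((pos (nth γ j) ℤ.+ pos (nth σ j)) ℤ.- pos w)) (sym (+-suc i j)) (delta-at (suc i) γ σ ps j l1 l2)

m-n≡pos⇒n≤m : ∀ m c a → pos m ℤ.- pos c ≡ pos a → c ≤ m
m-n≡pos⇒n≤m m c a e with c ≤? m
... | yes le = le
... | no nle with trans (sym (cong ℤ.sign (trans (sym (ℤP.m-n≡m⊖n m c)) e))) (ℤP.sign-⊖-< {m} {c} (≰⇒> nle))
...   | ()

nth-shape : ∀ (S : Tableau) j → nth (shape S) j ≡ length (rowAt S j)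
nth-shape [] j = refl
nth-shape (r ∷ S) zero = refl
nth-shape (r ∷ S) (suc j) = nth-shape S j

Δ-nonneg : ∀ (S : Tableau) σ α → HasContentTHC (shape S) σ α → length σ ≡ length S →
  ∀ j → j < length S → suc j ≤ length (rowAt S j) + nth σ j
Δ-nonneg S σ α H l j lt with delta-at {λ z → z ≡ 0ℤ ⊎ (∃[ a ] z ≡ pos a)} 1 (shape S) σ (fl-all (Δ (shape S) σ) (subst (All _) (sym H) (map-pos-nonneg α))) j
     (subst (j <_) (sym (LP.length-map length S)) lt) (subst (j <_) (sym l) lt)
... | inj₁ e = subst (λ w → suc j ≤ w + nth σ j) (nth-shape S j) (m-n≡pos⇒n≤m _ _ 0 e)
... | inj₂ (a , e) = subst (λ w → suc j ≤ w + nth σ j) (nth-shape S j) (m-n≡pos⇒n≤m _ _ a e)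

weight : ℕ → List ℕ → ℕ
weight i [] = 0
weight i (a ∷ as) = i * a + weight (suc i) as

dropZeros : List ℕ → List ℕ
dropZeros [] = []
dropZeros (zero ∷ D) = dropZeros D
dropZeros (suc a ∷ D) = suc a ∷ dropZeros D

-- Δ computed with truncated subtraction; it agrees with Δ once Δ ≥ 0 (Δ≡map-pos-deltaℕ).
deltaℕ : ℕ → List ℕ → List ℕ → List ℕ
deltaℕ i (g ∷ γ) (s ∷ σ) = (g + s) ∸ i ∷ deltaℕ (suc i) γ σ
deltaℕ i _ _ = []

pos-+-pos-∸ : ∀ g s i → i ≤ g + s → (pos g ℤ.+ pos s) ℤ.- pos i ≡ pos ((g + s) ∸ i)
pos-+-pos-∸ g s i le = trans (ℤP.m-n≡m⊖n (g + s) i) (ℤP.⊖-≥ le)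

Δ≡map-pos-deltaℕ : ∀ i γ σ → (∀ j → j < length γ → j < length σ → i + j ≤ nth γ j + nth σ j) → deltaFrom i γ σ ≡ map pos (deltaℕ i γ σ)
Δ≡map-pos-deltaℕ i [] σ h = refl
Δ≡map-pos-deltaℕ i (g ∷ γ) [] h = refl
Δ≡map-pos-deltaℕ i (g ∷ γ) (s ∷ σ) h = cong₂ _∷_ (pos-+-pos-∸ g s i (subst (_≤ g + s) (+-identityʳ i) (h 0 (s≤s z≤n) (s≤s z≤n))))
  (Δ≡map-pos-deltaℕ (suc i) γ σ (λ j a b → subst (_≤ nth γ j + nth σ j) (+-suc i j) (h (suc j) (s≤s a) (s≤s b))))

map-pos-injective : ∀ {xs ys : List ℕ} → map pos xs ≡ map pos ys → xs ≡ ys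
map-pos-injective = LP.map-injective ℤP.+-injective

fl-map-pos : ∀ D → fl (map pos D) ≡ map pos (dropZeros D)
fl-map-pos [] = refl
fl-map-pos (zero ∷ D) = fl-map-pos D
fl-map-pos (suc a ∷ D) = cong (pos (suc a) ∷_) (fl-map-pos D)

weight-mono : ∀ i D → weight i D ≤ weight (suc i) D
weight-mono i [] = z≤n
weight-mono i (a ∷ D) = +-mono-≤ (*-monoˡ-≤ a (n≤1+n i)) (weight-mono (suc i) D)

weight-dropZeros-≤ : ∀ i D → weight i (dropZeros D) ≤ weight i D
weight-dropZeros-≤ i [] = z≤n
weight-dropZeros-≤ i (zero ∷ D) = ≤-trans (weight-dropZeros-≤ i D) (≤-trans (weight-mono i D) (≤-reflexive (sym (cong (_+ weight (suc i) D) (*-zeroʳ i)))))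
weight-dropZeros-≤ i (suc a ∷ D) = +-monoʳ-≤ (i * suc a) (weight-dropZeros-≤ (suc i) D)

sqDist : ℕ → ℕ → ℕ
sqDist s i = (s ∸ i) * (s ∸ i) + (i ∸ s) * (i ∸ s)

sqDist-identity : ∀ s i → sqDist s i + 2 * (i * s) ≡ s * s + i * i
sqDist-identity s i with ≤-total s i
... | inj₁ le = subst (λ w → sqDist s w + 2 * (w * s) ≡ s * s + w * w) (m+[n∸m]≡n le) (lem s (i ∸ s))
  where
  lem : ∀ s t → sqDist s (s + t) + 2 * ((s + t) * s) ≡ s * s + (s + t) * (s + t)
  lem s t rewrite m+n∸m≡n s t | m≤n⇒m∸n≡0 (m≤m+n s t) = solve 2 (λ s t → (con 0 :* con 0 :+ t :* t) :+ con 2 :* ((s :+ t) :* s) := s :* s :+ (s :+ t) :* (s :+ t)) refl s t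
... | inj₂ le = subst (λ w → sqDist w i + 2 * (i * w) ≡ w * w + i * i) (m+[n∸m]≡n le) (lem i (s ∸ i))
  where
  lem : ∀ i t → sqDist (i + t) i + 2 * (i * (i + t)) ≡ (i + t) * (i + t) + i * i
  lem i t rewrite m+n∸m≡n i t | m≤n⇒m∸n≡0 (m≤m+n i t) = solve 2 (λ i t → (t :* t :+ con 0 :* con 0) :+ con 2 :* (i :* (i :+ t)) := (i :+ t) :* (i :+ t) :+ i :* i) refl i t

weight-term-identity : ∀ g s i → i ≤ g + s → 2 * (i * ((g + s) ∸ i)) + sqDist s i + i * i ≡ 2 * (i * g) + s * s
weight-term-identity g s i le = +-cancelʳ-≡ (2 * (i * s) + i * i) _ _ (begin
  2 * (i * D) + A + i * i + (2 * (i * s) + i * i)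
    ≡⟨ solve 4 (λ i D A s → con 2 :* (i :* D) :+ A :+ i :* i :+ (con 2 :* (i :* s) :+ i :* i) := con 2 :* (i :* (D :+ i)) :+ (A :+ con 2 :* (i :* s))) refl i D A s ⟩
  2 * (i * (D + i)) + (A + 2 * (i * s))
    ≡⟨ cong₂ (λ a b → 2 * (i * a) + b) (m∸n+n≡m le) (sqDist-identity s i) ⟩
  2 * (i * (g + s)) + (s * s + i * i)
    ≡⟨ solve 3 (λ i g s → con 2 :* (i :* (g :+ s)) :+ (s :* s :+ i :* i) := con 2 :* (i :* g) :+ s :* s :+ (con 2 :* (i :* s) :+ i :* i)) refl i g s ⟩
  2 * (i * g) + s * s + (2 * (i * s) + i * i) ∎)
  where
  open ≡-Reasoning
  D A : ℕ
  D = (g + s) ∸ i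
  A = sqDist s i

sqDistSum : ℕ → List ℕ → List ℕ → ℕ
sqDistSum i (g ∷ γ) (s ∷ σ) = sqDist s i + sqDistSum (suc i) γ σ
sqDistSum i _ _ = 0

indexSquareSum : ℕ → List ℕ → List ℕ → ℕ
indexSquareSum i (g ∷ γ) (s ∷ σ) = i * i + indexSquareSum (suc i) γ σ
indexSquareSum i _ _ = 0

squareSum : ℕ → List ℕ → List ℕ → ℕ
squareSum i (g ∷ γ) (s ∷ σ) = s * s + squareSum (suc i) γ σ
squareSum i _ _ = 0

-- Σ(σ_i − i)² = Σσ_i² − 2Σ i·σ_i + Σi², with every subtraction moved across.
weight-deltaℕ-identity : ∀ i γ σ → length γ ≡ length σ → (∀ j → j < length γ → j < length σ → i + j ≤ nth γ j + nth σ j) →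
  2 * weight i (deltaℕ i γ σ) + sqDistSum i γ σ + indexSquareSum i γ σ ≡ 2 * weight i γ + squareSum i γ σ
weight-deltaℕ-identity i [] [] _ _ = refl
weight-deltaℕ-identity i (g ∷ γ) (s ∷ σ) l h =
  trans (solve 6 (λ a b c d e f → con 2 :* (a :+ d) :+ (b :+ e) :+ (c :+ f) := (con 2 :* a :+ b :+ c) :+ (con 2 :* d :+ e :+ f)) refl (i * ((g + s) ∸ i)) (sqDist s i) (i * i) (weight (suc i) (deltaℕ (suc i) γ σ)) (sqDistSum (suc i) γ σ) (indexSquareSum (suc i) γ σ))
  (trans (cong₂ _+_ (weight-term-identity g s i (subst (_≤ g + s) (+-identityʳ i) (h 0 (s≤s z≤n) (s≤s z≤n))))
                    (weight-deltaℕ-identity (suc i) γ σ (suc-injective l) (λ j a b → subst (_≤ nth γ j + nth σ j) (+-suc i j) (h (suc j) (s≤s a) (s≤s b)))))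
    (solve 4 (λ a b c d → (con 2 :* a :+ b) :+ (con 2 :* c :+ d) := con 2 :* (a :+ c) :+ (b :+ d)) refl (i * g) (s * s) (weight (suc i) γ) (squareSum (suc i) γ σ)))

square : ℕ → ℕ
square v = v * v

squareSum≡sum : ∀ i γ σ → length γ ≡ length σ → squareSum i γ σ ≡ sum (map square σ)
squareSum≡sum i [] [] _ = refl
squareSum≡sum i (g ∷ γ) (s ∷ σ) l = cong (λ w → s * s + w) (squareSum≡sum (suc i) γ σ (suc-injective l))

squaresFrom : ℕ → ℕ → ℕ
squaresFrom i zero = 0
squaresFrom i (suc n) = i * i + squaresFrom (suc i) n

indexSquareSum≡squaresFrom : ∀ i γ σ → length γ ≡ length σ → indexSquareSum i γ σ ≡ squaresFrom i (length σ)
indexSquareSum≡squaresFrom i [] [] _ = refl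
indexSquareSum≡squaresFrom i (g ∷ γ) (s ∷ σ) l = cong (λ w → i * i + w) (indexSquareSum≡squaresFrom (suc i) γ σ (suc-injective l))

squaresFrom-suc : ∀ i n → squaresFrom i (suc n) ≡ squaresFrom i n + (i + n) * (i + n)
squaresFrom-suc i zero rewrite +-identityʳ i = +-identityʳ (i * i)
squaresFrom-suc i (suc n) = trans (cong (λ w → i * i + w) (squaresFrom-suc (suc i) n))
  (trans (sym (+-assoc (i * i) _ _)) (cong (λ w → i * i + squaresFrom (suc i) n + w * w) (sym (+-suc i n))))

squaresFrom-identityPerm : ∀ n → squaresFrom 1 n ≡ sum (map square (identityPerm n))
squaresFrom-identityPerm zero = refl
squaresFrom-identityPerm (suc n) = trans (squaresFrom-suc 1 n)
  (trans (cong (_+ suc n * suc n) (squaresFrom-identityPerm n))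
    (sym (trans (cong (λ l → sum (map square l)) (identityPerm-suc n))
      (trans (cong sum (LP.map-++ square (identityPerm n) [ suc n ])) (trans (sum-++ (map square (identityPerm n)) [ square (suc n) ]) (cong (sum (map square (identityPerm n)) +_) (+-identityʳ _)))))))

squareSum-perm : ∀ γ σ → length γ ≡ length σ → IsPerm σ → squareSum 1 γ σ ≡ indexSquareSum 1 γ σ
squareSum-perm γ σ l P = trans (squareSum≡sum 1 γ σ l) (trans (sum-↭ (PermP.map⁺ square P)) (trans (sym (squaresFrom-identityPerm (length σ))) (sym (indexSquareSum≡squaresFrom 1 γ σ l))))

sqDist≡0⇒≡ : ∀ s i → sqDist s i ≡ 0 → s ≡ i
sqDist≡0⇒≡ s i e = ≤-antisym (m∸n≡0⇒m≤n (sq0 (s ∸ i) (m+n≡0⇒m≡0 _ e))) (m∸n≡0⇒m≤n (sq0 (i ∸ s) (m+n≡0⇒n≡0 ((s ∸ i) * (s ∸ i)) e)))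
  where
  sq0 : ∀ m → m * m ≡ 0 → m ≡ 0
  sq0 zero _ = refl

sqDistSum≡0⇒id : ∀ i γ σ → sqDistSum i γ σ ≡ 0 → ∀ j → j < length γ → j < length σ → nth σ j ≡ i + j
sqDistSum≡0⇒id i (g ∷ γ) (s ∷ σ) e zero _ _ = trans (sqDist≡0⇒≡ s i (m+n≡0⇒m≡0 _ e)) (sym (+-identityʳ i))
sqDistSum≡0⇒id i (g ∷ γ) (s ∷ σ) e (suc j) (s≤s a) (s≤s b) = trans (sqDistSum≡0⇒id (suc i) γ σ (m+n≡0⇒n≡0 (sqDist s i) e) j a b) (sym (+-suc i j))

+-≤-≡-split : ∀ {a b c d} → a ≤ b → c ≤ d → a + c ≡ b + d → a ≡ b × c ≡ d
+-≤-≡-split {a} {b} {c} {d} ab cd e = ab' , +-cancelˡ-≡ a c d (trans e (cong (_+ d) (sym ab')))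
  where
  ab' : a ≡ b
  ab' = ≤-antisym ab (+-cancelʳ-≤ d b a (≤-trans (≤-reflexive (sym e)) (+-monoʳ-≤ a cd)))

*-length-≤-sum : ∀ c r → All (c ≤_) r → c * length r ≤ sum r
*-length-≤-sum c [] _ = ≤-reflexive (*-zeroʳ c)
*-length-≤-sum c (e ∷ r) (p ∷ ps) = subst (_≤ e + sum r) (sym (*-suc c (length r))) (+-mono-≤ p (*-length-≤-sum c r ps))

*-length-≡-sum : ∀ c r → All (c ≤_) r → c * length r ≡ sum r → All (_≡ c) r
*-length-≡-sum c [] _ _ = []
*-length-≡-sum c (e ∷ r) (p ∷ ps) h with +-≤-≡-split p (*-length-≤-sum c r ps) (trans (sym (*-suc c (length r))) h)
... | (a , b) = sym a ∷ *-length-≡-sum c r ps b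

weight-shape-≤-entrySum : ∀ i (S : Tableau) → (∀ j → All (i + j ≤_) (rowAt S j)) → weight i (shape S) ≤ sum (map sum S)
weight-shape-≤-entrySum i [] h = z≤n
weight-shape-≤-entrySum i (r ∷ S) h = +-mono-≤ (*-length-≤-sum i r (subst (λ w → All (w ≤_) r) (+-identityʳ i) (h 0))) (weight-shape-≤-entrySum (suc i) S (λ j → subst (λ w → All (w ≤_) (rowAt S j)) (+-suc i j) (h (suc j))))

weight-shape-≡-entrySum : ∀ i (S : Tableau) → (∀ j → All (i + j ≤_) (rowAt S j)) → weight i (shape S) ≡ sum (map sum S) → ∀ j → All (_≡ i + j) (rowAt S j)
weight-shape-≡-entrySum i [] h e j = []
weight-shape-≡-entrySum i (r ∷ S) h e j with +-≤-≡-split (*-length-≤-sum i r h0) (weight-shape-≤-entrySum (suc i) S h1) e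
  where
  h0 = subst (λ w → All (w ≤_) r) (+-identityʳ i) (h 0)
  h1 = λ j → subst (λ w → All (w ≤_) (rowAt S j)) (+-suc i j) (h (suc j))
weight-shape-≡-entrySum i (r ∷ S) h e zero | (a , b) = subst (λ w → All (_≡ w) r) (sym (+-identityʳ i)) (*-length-≡-sum i r (subst (λ w → All (w ≤_) r) (+-identityʳ i) (h 0)) a)
weight-shape-≡-entrySum i (r ∷ S) h e (suc j) | (a , b) = subst (λ w → All (_≡ w) (rowAt S j)) (sym (+-suc i j)) (weight-shape-≡-entrySum (suc i) S (λ j → subst (λ w → All (w ≤_) (rowAt S j)) (+-suc i j) (h (suc j))) b j)

indicator : ℕ → ℕ → ℕ
indicator v e = if v ≡ᵇ e then 1 else 0

rowValueSum : ℕ → ℕ → List ℕ → ℕ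
rowValueSum i zero row = 0
rowValueSum i (suc L) row = i * countL i row + rowValueSum (suc i) L row

valueSum : ℕ → ℕ → Tableau → ℕ
valueSum i L S = sum (map (rowValueSum i L) S)

rowValueSum-∷ : ∀ i L e row → rowValueSum i L (e ∷ row) ≡ rowValueSum i L [ e ] + rowValueSum i L row
rowValueSum-∷ i zero e row = refl
rowValueSum-∷ i (suc L) e row rewrite rowValueSum-∷ (suc i) L e row =
  solve 5 (λ i b c d f → i :* (b :+ c) :+ (d :+ f) := (i :* (b :+ con 0) :+ d) :+ (i :* c :+ f)) refl i (indicator i e) (countL i row) (rowValueSum (suc i) L [ e ]) (rowValueSum (suc i) L row)

rowValueSum-below : ∀ i L e → e < i → rowValueSum i L [ e ] ≡ 0
rowValueSum-below i zero e lt = refl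
rowValueSum-below i (suc L) e lt rewrite ≢⇒≡ᵇ-false i e (λ x → <-irrefl (sym x) lt) | *-zeroʳ i = rowValueSum-below (suc i) L e (<-trans lt (n<1+n i))

rowValueSum-single : ∀ i L e → i ≤ e → e < i + L → rowValueSum i L [ e ] ≡ e
rowValueSum-single i zero e le lt = ⊥-elim (<-irrefl refl (≤-trans lt (≤-trans (≤-reflexive (+-identityʳ i)) le)))
rowValueSum-single i (suc L) e le lt with m≤n⇒m<n∨m≡n le
... | inj₂ refl rewrite ≡ᵇ-refl i | rowValueSum-below (suc i) L i (n<1+n i) = trans (+-identityʳ _) (*-identityʳ i)
... | inj₁ il rewrite ≢⇒≡ᵇ-false i e (λ x → <-irrefl x il) | *-zeroʳ i = rowValueSum-single (suc i) L e il (subst (e <_) (+-suc i L) lt)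

rowValueSum≡sum : ∀ i L row → All (λ e → i ≤ e × e < i + L) row → rowValueSum i L row ≡ sum row
rowValueSum≡sum i L [] _ = vR0 i L
  where
  vR0 : ∀ i L → rowValueSum i L [] ≡ 0
  vR0 i zero = refl
  vR0 i (suc L) rewrite *-zeroʳ i = vR0 (suc i) L
rowValueSum≡sum i L (e ∷ row) ((a , b) ∷ ps) = trans (rowValueSum-∷ i L e row) (cong₂ _+_ (rowValueSum-single i L e a b) (rowValueSum≡sum i L row ps))

valueSum-zero : ∀ i (S : Tableau) → valueSum i 0 S ≡ 0
valueSum-zero i [] = refl
valueSum-zero i (r ∷ S) = valueSum-zero i S

valueSum-suc : ∀ i L (S : Tableau) → valueSum i (suc L) S ≡ i * countT i S + valueSum (suc i) L S
valueSum-suc i L [] = sym (cong (_+ 0) (*-zeroʳ i))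
valueSum-suc i L (r ∷ S) rewrite valueSum-suc i L S =
  solve 5 (λ i a b c d → (i :* a :+ b) :+ (i :* c :+ d) := i :* (a :+ c) :+ (b :+ d)) refl i (countL i r) (rowValueSum (suc i) L r) (countT i S) (valueSum (suc i) L S)

weight≡valueSum : ∀ i β' (S : Tableau) → (∀ v → nth β' v ≡ countT (i + v) S) → weight i β' ≡ valueSum i (length β') S
weight≡valueSum i [] S h = sym (valueSum-zero i S)
weight≡valueSum i (b ∷ β') S h = trans (cong₂ _+_ (cong (i *_) (trans (h 0) (cong (λ w → countT w S) (+-identityʳ i))))
   (weight≡valueSum (suc i) β' S (λ v → trans (h (suc v)) (cong (λ w → countT w S) (+-suc i v))))) (sym (valueSum-suc i (length β') S))

valueSum≡entrySum : ∀ i L (S : Tableau) → (∀ j → All (λ e → i ≤ e × e < i + L) (rowAt S j)) → valueSum i L S ≡ sum (map sum S)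
valueSum≡entrySum i L [] h = refl
valueSum≡entrySum i L (r ∷ S) h = cong₂ _+_ (rowValueSum≡sum i L r (h 0)) (valueSum≡entrySum i L S (λ j → h (suc j)))

weight-content≡entrySum : ∀ (S : Tableau) β → HasContentT S β → (∀ j → All (λ e → 1 ≤ e × e < 1 + length β) (rowAt S j)) → weight 1 β ≡ sum (map sum S)
weight-content≡entrySum S β C h = trans (weight≡valueSum 1 β S (λ v → sym (C v))) (valueSum≡entrySum 1 (length β) S h)

∈-dropLast : ∀ {e : ℕ} row → e ∈ dropLast row → e ∈ row
∈-dropLast (a ∷ []) ()
∈-dropLast (a ∷ b ∷ row) (here e) = here e
∈-dropLast (a ∷ b ∷ row) (there h) = there (∈-dropLast (b ∷ row) h)

∈-snoc⁻ : ∀ {e : ℕ} row x → e ∈ row ++ [ x ] → e ∈ row ⊎ e ≡ x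
∈-snoc⁻ row x h with ∈-++⁻ row h
... | inj₁ a = inj₁ a
... | inj₂ (here e) = inj₂ e

-- ψ τ T is determined by where the settled tail starts and by the unique
-- σ-minimal row containing x; both ψ(T,S) and ψ(V,U) are computed through this.
ψ-from-spec : ∀ τ T ℓ' M' c' x' p0 q' →
   length T ≡ ℓ' → length τ ≡ ℓ' → maxEntry T ≡ M' → x' + ℓ' ≡ M' + suc c' → c' < ℓ' →
   (∀ j → suc c' ≤ j → j < ℓ' → Settled ℓ' M' τ T j) → ¬ Settled ℓ' M' τ T c' →
   p0 < ℓ' → x' ∈ rowAt T p0 → nth τ p0 ≡ q' →
   (∀ j → j < ℓ' → x' ∈ rowAt T j → q' ≤ nth τ j) →
   (∀ j → j < ℓ' → x' ∈ rowAt T j → nth τ j ≡ q' → j ≡ p0) →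
   PsiAux.k τ T ≡ suc c' × ψ τ T ≡ PsiAux.stepR τ T (just (suc p0 , q'))
ψ-from-spec τ T .(length T) .(maxEntry T) c' x' p0 q' refl lτ refl xe cl tl ng p0l xp0 τp0 mn un = kτ , ψe
  where
  open PsiSpec τ T
  kτ : PsiAux.k τ T ≡ suc c'
  kτ = kFrom-unique (length T) (suc c') cl (λ j a b → Settled⇒good j (tl j a b)) (inj₂ (c' , refl , ¬Settled⇒good-false c' ng))
  Bt : ∀ row → containsX row ≡ true → x' ∈ row
  Bt row h = Any.map f (any-true _ row h)
    where
    f : ∀ {e} → PsiAux.isVal τ T (PsiAux.k τ T) e ≡ true → x' ≡ e
    f {e} t = sym (+-cancelʳ-≡ (length T) e x' (trans (subst (λ w → e + length T ≡ maxEntry T + w) kτ (isVal-true _ e t)) (sym xe)))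
  Bt⁻ : ∀ row → x' ∈ row → containsX row ≡ true
  Bt⁻ row h = any-true⁻ _ row (Any.map f h)
    where
    f : ∀ {e} → x' ≡ e → PsiAux.isVal τ T (PsiAux.k τ T) e ≡ true
    f {e} refl = isVal-true⁻ _ x' (trans xe (cong (maxEntry T +_) (sym kτ)))
  ψe : ψ τ T ≡ PsiAux.stepR τ T (just (suc p0 , q'))
  ψe = fin (best-exists lτ (p0 , Bt⁻ _ xp0))
    where
    fin : (∃[ r0 ] ∃[ q ] (PsiAux.best τ T 1 τ T nothing ≡ just (suc r0 , q) × r0 < length T × containsX (rowAt T r0) ≡ true × nth τ r0 ≡ q × MinimalAt τ T q)) →
          ψ τ T ≡ PsiAux.stepR τ T (just (suc p0 , q'))
    fin (r' , q'' , beq , r'l , br' , τr' , mn') = trans (ψ-k≡suc τ T c' kτ) (cong (PsiAux.stepR τ T) (trans beq (cong₂ (λ a b → just (suc a , b)) rr qq)))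
      where
      xr' : x' ∈ rowAt T r'
      xr' = Bt _ br'
      qq : q'' ≡ q'
      qq = ≤-antisym (subst (q'' ≤_) τp0 (mn' p0 (subst (p0 <_) (sym lτ) p0l) (Bt⁻ _ xp0))) (subst (q' ≤_) τr' (mn r' r'l xr'))
      rr : r' ≡ p0
      rr = un r' r'l xr' (trans τr' qq)

xValue : Tableau → ℕ → ℕ
xValue S c = (maxEntry S + suc c) ∸ length S

stepR-insert : ∀ σ S c r q → PsiAux.k σ S ≡ suc c → q ≡ suc c →
  PsiAux.stepR σ S (just (r , q)) ≡ (sAct (suc c) (σ ++ [ suc (length S) ]) , insertAt (suc c) [ xValue S c ] (updateAt (r ∸ 1) dropLast S))
stepR-insert σ S c r q kc qe with PsiAux.k σ S | kc
... | .(suc c) | refl rewrite qe | ≡ᵇ-refl c = refl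

moveEntry : Tableau → ℕ → ℕ → ℕ → Tableau
moveEntry S X r p = updateAt (p ∸ 1) (λ row → row ++ [ X ]) (updateAt (r ∸ 1) dropLast S)

moveResult : List ℕ → Tableau → ℕ → ℕ → ℕ → ℕ → List ℕ × Tableau
moveResult σ S X r q p = if isEmpty (rowAt (moveEntry S X r p) (r ∸ 1))
  then (dropLast (sAct q σ) , removeAt (r ∸ 1) (moveEntry S X r p))
  else (sAct q σ , moveEntry S X r p)

moveResult-emptied : ∀ σ S X r q p → rowAt (moveEntry S X r p) (r ∸ 1) ≡ [] →
  moveResult σ S X r q p ≡ (dropLast (sAct q σ) , removeAt (r ∸ 1) (moveEntry S X r p))
moveResult-emptied σ S X r q p h rewrite h = refl

moveResult-nonEmpty : ∀ σ S X r q p a as → rowAt (moveEntry S X r p) (r ∸ 1) ≡ a ∷ as →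
  moveResult σ S X r q p ≡ (sAct q σ , moveEntry S X r p)
moveResult-nonEmpty σ S X r q p a as h rewrite h = refl

stepR-move : ∀ σ S c r q p → PsiAux.k σ S ≡ suc c → q ≢ suc c → posOf (suc q) σ ≡ just p →
  PsiAux.stepR σ S (just (r , q)) ≡ moveResult σ S (xValue S c) r q p
stepR-move σ S c r q p kc qne pe with posOf (suc q) σ | pe
... | .(just p) | refl with PsiAux.k σ S | kc
... | .(suc c) | refl rewrite ≢⇒≡ᵇ-false q (suc c) qne = refl

SignReversingInvolutionAt : List ℕ → Tableau → Set
SignReversingInvolutionAt σ S = sgn (proj₁ (ψ σ S)) ≡ - sgn σ × ψ (proj₁ (ψ σ S)) (proj₂ (ψ σ S)) ≡ (σ , S)

module PsiInvolution (σ : List ℕ) (S : Tableau) (α β : List ℕ)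
  (Pσ : IsPerm σ) (lenσ : length σ ≡ length S) (Imm : IsImmaculate S)
  (Hα : HasContentTHC (shape S) σ α) (Hβ : HasContentT S β) (βpos : All (1 ≤_) β)
  (c : ℕ) (kc : PsiAux.k σ S ≡ suc c) where

  ℓ : ℕ
  ℓ = length S
  M : ℕ
  M = maxEntry S
  k : ℕ
  k = suc c

  open ImmaculateFacts (immaculateFacts S Imm)
  module PF = IsPermProperties σ Pσ
  open PsiSpec σ S
  open PsiAux σ S using (good)


  c<ℓ : c < ℓ
  c<ℓ = subst (_≤ ℓ) kc (proj₁ (kFrom-spec ℓ))

  settled-tail : ∀ j → k ≤ j → j < ℓ → Settled ℓ M σ S j
  settled-tail j le lt = good⇒Settled j (proj₁ (proj₂ (kFrom-spec ℓ)) j (subst (_≤ j) (sym kc) le) lt)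

  unsettled-k : ¬ Settled ℓ M σ S c
  unsettled-k with proj₂ (proj₂ (kFrom-spec ℓ))
  ... | inj₁ e = ⊥-elim (0≢1+n (trans (sym e) kc))
  ... | inj₂ (c' , e , g) = good-false⇒¬Settled c (subst (λ w → good (suc w) ≡ false) (suc-injective (trans (sym e) kc)) g)

  σ-tail : ∀ j → k ≤ j → j < ℓ → nth σ j ≡ suc j
  σ-tail j le lt = proj₁ (settled-tail j le lt)
  row-tail : ∀ j → k ≤ j → j < ℓ → All (λ e → e + ℓ ≡ M + suc j) (rowAt S j)
  row-tail j le lt = proj₁ (proj₂ (settled-tail j le lt))
  tail-value-elsewhere : ∀ j → k ≤ j → j < ℓ → ∀ j' → j' ≢ j → All (λ e → e + ℓ ≢ M + suc j) (rowAt S j')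
  tail-value-elsewhere j le lt = proj₂ (proj₂ (settled-tail j le lt))

  ℓ≤Mk : ℓ ≤ M + k
  ℓ≤Mk with m≤n⇒m<n∨m≡n c<ℓ
  ... | inj₂ e = subst (_≤ M + k) e (m≤n+m k M)
  ... | inj₁ lt with rowAt S k in eqr | nonempty k lt | row-tail k ≤-refl lt | entries-ge k
  ...   | e ∷ _ | _ | p ∷ _ | q ∷ _ = ≤-pred (≤-trans (+-monoˡ-≤ ℓ (≤-trans (s≤s z≤n) q)) (≤-trans (≤-reflexive p) (≤-reflexive (+-suc M k))))

  x : ℕ
  x = (M + k) ∸ ℓ

  xeq : x + ℓ ≡ M + k
  xeq = m∸n+n≡m ℓ≤Mk

  x≤M : x ≤ M
  x≤M = +-cancelʳ-≤ ℓ x M (subst (_≤ M + ℓ) (sym xeq) (+-monoʳ-≤ M c<ℓ))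

  -- Any value above x is M − ℓ + i for some i > k, and condition (c) confines it to row i.
  entries-≤x : ∀ j → j < k → ∀ {e} → e ∈ rowAt S j → e ≤ x
  entries-≤x j jk {e} em with x <? e
  ... | no nlt = ≮⇒≥ nlt
  ... | yes xe = ⊥-elim (All.lookup (tail-value-elsewhere i ki iℓ j (λ je → <-irrefl refl (≤-trans (subst (_< k) je jk) ki))) em eqi)
    where
    entry≤M : e ≤ M
    entry≤M = maxEntry-ub S j e em
    gt : M + k < e + ℓ
    gt = subst (_< e + ℓ) xeq (+-monoˡ-< ℓ xe)
    sM : suc M ≤ e + ℓ
    sM = ≤-trans (s≤s (m≤m+n M k)) gt
    i : ℕ
    i = (e + ℓ) ∸ suc M
    eqi : e + ℓ ≡ M + suc i
    eqi = trans (sym (m∸n+n≡m sM)) (trans (+-comm i (suc M)) (sym (+-suc M i)))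
    ki : k ≤ i
    ki = ≤-pred (+-cancelˡ-< M k (suc i) (subst (M + k <_) eqi gt))
    iℓ : i < ℓ
    iℓ = +-cancelˡ-≤ M (suc i) ℓ (subst (_≤ M + ℓ) eqi (+-monoˡ-≤ ℓ entry≤M))

  1≤x : 1 ≤ x
  1≤x = ≤-trans (s≤s z≤n) (≤-trans (All.lookup (entries-ge c) (hd-mem c c<ℓ)) (entries-≤x c ≤-refl (hd-mem c c<ℓ)))

  x-occurs : ∃[ j ] (j < ℓ × x ∈ rowAt S j)
  x-occurs = values-occur S β Hβ βpos (immaculateFacts S Imm) c _ (hd-mem c c<ℓ) x 1≤x x≤M

  x-row<k : ∀ j → x ∈ rowAt S j → j < k
  x-row<k j xm with j <? k
  ... | yes lt = lt
  ... | no nlt with j <? ℓ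
  ...   | no nℓ = ⊥-elim (nomem (subst (x ∈_) (rowAt-beyond S j (≮⇒≥ nℓ)) xm))
    where
    nomem : ¬ (x ∈ [])
    nomem ()
  ...   | yes jℓ = ⊥-elim (nlt (≤-reflexive (+-cancelˡ-≡ M (suc j) k (trans (sym (All.lookup (row-tail j (≮⇒≥ nlt) jℓ) xm)) xeq))))

  σrange : ∀ j → j < ℓ → 1 ≤ nth σ j × nth σ j ≤ ℓ
  σrange j lt with PF.nth-bounds j (subst (j <_) (sym lenσ) lt)
  ... | (a , b) = a , subst (nth σ j ≤_) lenσ b

  σinj : ∀ i j → i < ℓ → j < ℓ → nth σ i ≡ nth σ j → i ≡ j
  σinj i j il jl = PF.nth-injective i j (subst (i <_) (sym lenσ) il) (subst (j <_) (sym lenσ) jl)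

  σsurj : ∀ v → 1 ≤ v → v ≤ ℓ → ∃[ j ] (j < ℓ × nth σ j ≡ v)
  σsurj v a b with PF.nth-surjective v a (subst (v ≤_) (sym lenσ) b)
  ... | (j , lt , e) = j , subst (j <_) lenσ lt , e

  σ≤k : ∀ j → j < k → nth σ j ≤ k
  σ≤k j jk with σrange j (≤-trans jk c<ℓ) | k <? nth σ j
  ... | _ | no n = ≮⇒≥ n
  ... | (a , b) | yes kv = ⊥-elim (<-irrefl refl (≤-trans (subst (_< k) je jk) kv'))
    where
    v = nth σ j
    pv = pred v
    spv : suc pv ≡ v
    spv = suc-pred v {{>-nonZero a}}
    kv' : k ≤ pv
    kv' = ≤-pred (subst (k <_) (sym spv) kv)
    pvℓ : pv < ℓ
    pvℓ = subst (_≤ ℓ) (sym spv) b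
    je : j ≡ pv
    je = σinj j pv (≤-trans jk c<ℓ) pvℓ (sym (trans (σ-tail pv kv' pvℓ) spv))

  containsX⇒x∈ : ∀ row → containsX row ≡ true → x ∈ row
  containsX⇒x∈ row h = Any.map f (any-true _ row h)
    where
    f : ∀ {e} → PsiAux.isVal σ S (PsiAux.k σ S) e ≡ true → x ≡ e
    f {e} t = sym (+-cancelʳ-≡ ℓ e x (trans (subst (λ w → e + ℓ ≡ M + w) kc (isVal-true _ e t)) (sym xeq)))

  x∈⇒containsX : ∀ row → x ∈ row → containsX row ≡ true
  x∈⇒containsX row h = any-true⁻ _ row (Any.map f h)
    where
    f : ∀ {e} → x ≡ e → PsiAux.isVal σ S (PsiAux.k σ S) e ≡ true
    f {e} refl = isVal-true⁻ _ x (trans xeq (cong (M +_) (sym kc)))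

  module MinimalRow (r0 q : ℕ) (beq : PsiAux.best σ S 1 σ S nothing ≡ just (suc r0 , q)) (r0ℓ : r0 < ℓ)
    (xr0 : x ∈ rowAt S r0) (σr0 : nth σ r0 ≡ q) (qmin : ∀ j → j < ℓ → x ∈ rowAt S j → q ≤ nth σ j) where

    r0k : r0 < k
    r0k = x-row<k r0 xr0
    qk : q ≤ k
    qk = subst (_≤ k) σr0 (σ≤k r0 r0k)
    q1 : 1 ≤ q
    q1 = subst (1 ≤_) σr0 (proj₁ (σrange r0 r0ℓ))

    ψ-eq : ψ σ S ≡ PsiAux.stepR σ S (just (suc r0 , q))
    ψ-eq = trans (ψ-k≡suc σ S c kc) (cong (PsiAux.stepR σ S) beq)

    kℓ-split : k ≡ ℓ ⊎ ∃[ ℓ1 ] (suc ℓ1 ≡ ℓ × k ≤ ℓ1)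
    kℓ-split = f c<ℓ
      where
      f : ∀ {a b} → suc a ≤ b → suc a ≡ b ⊎ ∃[ ℓ1 ] (suc ℓ1 ≡ b × suc a ≤ ℓ1)
      f {a} {b} le with m≤n⇒m<n∨m≡n le
      f {a} {suc b} le | inj₁ lt = inj₂ (b , refl , ≤-pred lt)
      f {a} {b} le | inj₂ e = inj₁ e

    shift : ∀ a b c d → a + suc b ≡ c + suc d → a + b ≡ c + d
    shift a b c d e = suc-injective (trans (sym (+-suc a b)) (trans e (+-suc c d)))

    ≤x⇒not-tail-value : ∀ j' → k ≤ j' → ∀ e → e ≤ x → e + ℓ ≢ M + suc j'
    ≤x⇒not-tail-value j' le e ex eq = <-irrefl refl (≤-trans (s≤s le) (+-cancelˡ-≤ M (suc j') k (subst (_≤ M + k) eq (subst (e + ℓ ≤_) xeq (+-monoˡ-≤ ℓ ex)))))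

    entry≤M : ∀ j {e} → e ∈ rowAt S j → e ≤ M
    entry≤M j {e} h = maxEntry-ub S j e h

    trich : ∀ j → j < k ⊎ j ≡ k ⊎ ∃[ j' ] (j ≡ suc j' × k ≤ j')
    trich j with <-cmp j k
    ... | tri< a _ _ = inj₁ a
    ... | tri≈ _ b _ = inj₂ (inj₁ b)
    ... | tri> _ _ (s≤s c') = inj₂ (inj₂ (_ , refl , c'))

    M∈last-row : ∀ ℓ1 → suc ℓ1 ≡ ℓ → k ≤ ℓ1 → M ∈ rowAt S ℓ1
    M∈last-row ℓ1 e le = subst (_∈ rowAt S ℓ1) eqM (hd-mem ℓ1 lt)
      where
      lt : ℓ1 < ℓ
      lt = ≤-reflexive e
      eqM : hd (rowAt S ℓ1) ≡ M
      eqM = +-cancelʳ-≡ ℓ _ M (trans (All.lookup (row-tail ℓ1 le lt) (hd-mem ℓ1 lt)) (trans (cong (M +_) e) refl))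

    x≡M : k ≡ ℓ → x ≡ M
    x≡M e = +-cancelʳ-≡ ℓ x M (trans xeq (cong (M +_) e))

    σ≤suc-ℓ : All (_≤ suc ℓ) σ
    σ≤suc-ℓ = All.tabulate f
      where
      f : ∀ {v} → v ∈ σ → v ≤ suc ℓ
      f {v} h with countL-pos⇒nth v σ (∈⇒countL-pos v σ h)
      ... | (j , lt , refl) = ≤-trans (proj₂ (σrange j (subst (j <_) lenσ lt))) (n≤1+n ℓ)

    countL-σ-≡1 : ∀ v → 1 ≤ v → v ≤ ℓ → countL v σ ≡ 1
    countL-σ-≡1 v a b = PF.countL-≡1 v a (subst (v ≤_) (sym lenσ) b)

    countL-σ-suc-ℓ : countL (suc ℓ) σ ≡ 0
    countL-σ-suc-ℓ = trans (PF.countL-identityPerm (suc ℓ)) (countL-identityPerm-out (length σ) (suc ℓ) (inj₂ (s≤s (≤-reflexive lenσ))))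

    -- Step (4); ψ then takes step (5) on the new row [x], empties it and undoes the insertion.
    module InsertCase (qk : q ≡ k) where
      S1 : Tableau
      S1 = updateAt r0 dropLast S
      UA : Tableau
      UA = insertAt k [ x ] S1
      σA : List ℕ
      σA = sAct k (σ ++ [ suc ℓ ])

      ψ-S-insert : ψ σ S ≡ (σA , UA)
      ψ-S-insert = trans ψ-eq (stepR-insert σ S c (suc r0) q kc qk)

      lenS1 : length S1 ≡ ℓ
      lenS1 = length-updateAt r0 dropLast S
      kS1 : k ≤ length S1
      kS1 = subst (k ≤_) (sym lenS1) c<ℓ
      lenUA : length UA ≡ suc ℓ
      lenUA = trans (length-insertAt k [ x ] S1 kS1) (cong suc lenS1)
      lenσA : length σA ≡ suc ℓ
      lenσA = trans (length-sAct k (σ ++ [ suc ℓ ])) (trans (length-snoc σ (suc ℓ)) (cong suc lenσ))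

      S1-ne : ∀ j → j ≢ r0 → rowAt S1 j ≡ rowAt S j
      S1-ne j ne = rowAt-updateAt-≢ r0 dropLast S j ne
      S1-r0 : rowAt S1 r0 ≡ dropLast (rowAt S r0)
      S1-r0 = rowAt-updateAt-≡ r0 dropLast S r0ℓ
      S1-sub : ∀ j {e} → e ∈ rowAt S1 j → e ∈ rowAt S j
      S1-sub j {e} h with j ≟ r0
      ... | yes refl = ∈-dropLast (rowAt S r0) (subst (e ∈_) S1-r0 h)
      ... | no ne = subst (e ∈_) (S1-ne j ne) h

      rA-lt : ∀ j → j < k → rowAt UA j ≡ rowAt S1 j
      rA-lt j lt = rowAt-insertAt-< k [ x ] S1 j lt kS1
      rA-k : rowAt UA k ≡ [ x ]
      rA-k = rowAt-insertAt-≡ k [ x ] S1 kS1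
      rA-gt : ∀ j → k ≤ j → rowAt UA (suc j) ≡ rowAt S j
      rA-gt j le = trans (rowAt-insertAt-> k [ x ] S1 j le kS1) (S1-ne j (λ e → <-irrefl refl (≤-trans (subst (_< k) (sym e) r0k) le)))

      σA-lt : ∀ j → j < ℓ → nth σA j ≡ swapAdj k (nth σ j)
      σA-lt j lt = trans (nth-sAct k (σ ++ [ suc ℓ ]) j (subst (j <_) (sym (trans (length-snoc σ (suc ℓ)) (cong suc lenσ))) (<-trans lt (n<1+n ℓ))))
                         (cong (swapAdj k) (nth-snoc-< σ (suc ℓ) j (subst (j <_) (sym lenσ) lt)))
      σA-ℓ : nth σA ℓ ≡ swapAdj k (suc ℓ)
      σA-ℓ = trans (nth-sAct k (σ ++ [ suc ℓ ]) ℓ (subst (ℓ <_) (sym (trans (length-snoc σ (suc ℓ)) (cong suc lenσ))) (n<1+n ℓ)))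
                   (cong (swapAdj k) (subst (λ w → nth (σ ++ [ suc ℓ ]) w ≡ suc ℓ) lenσ (nth-snoc-last σ (suc ℓ))))

      xonly : ∀ j → x ∈ rowAt S j → j ≡ r0
      xonly j h = σinj j r0 jℓ r0ℓ (trans (≤-antisym (σ≤k j jk) (subst (_≤ nth σ j) qk (qmin j jℓ h))) (sym (trans σr0 qk)))
        where
        jk = x-row<k j h
        jℓ = ≤-trans jk c<ℓ

      σA-k : nth σA k ≡ k
      σA-k with m≤n⇒m<n∨m≡n c<ℓ
      ... | inj₁ lt = trans (σA-lt k lt) (trans (cong (swapAdj k) (σ-tail k ≤-refl lt)) (swapAdj-suc k))
      ... | inj₂ e = trans (cong (nth σA) e) (trans σA-ℓ (trans (cong (λ w → swapAdj k (suc w)) (sym e)) (swapAdj-suc k)))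

      σA-r0 : nth σA r0 ≡ suc k
      σA-r0 = trans (σA-lt r0 r0ℓ) (trans (cong (swapAdj k) (trans σr0 qk)) (swapAdj-k k))

      rowUA : ∀ j {e} → e ∈ rowAt UA j → (j < k × e ∈ rowAt S j) ⊎ (j ≡ k × e ≡ x) ⊎ (∃[ j' ] (j ≡ suc j' × k ≤ j' × e ∈ rowAt S j'))
      rowUA j {e} h with trich j
      ... | inj₁ lt = inj₁ (lt , S1-sub j (subst (e ∈_) (rA-lt j lt) h))
      ... | inj₂ (inj₁ refl) with subst (e ∈_) rA-k h
      ...   | here ex = inj₂ (inj₁ (refl , ex))
      rowUA j {e} h | inj₂ (inj₂ (j' , refl , le)) = inj₂ (inj₂ (j' , refl , le , subst (e ∈_) (rA-gt j' le) h))

      maxUA : maxEntry UA ≡ M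
      maxUA = maxEntry-≡ UA M (λ j → All.tabulate (f j)) occ
        where
        f : ∀ j {e} → e ∈ rowAt UA j → e ≤ M
        f j h with rowUA j h
        ... | inj₁ (_ , m) = entry≤M j m
        ... | inj₂ (inj₁ (_ , refl)) = x≤M
        ... | inj₂ (inj₂ (j' , _ , _ , m)) = entry≤M j' m
        occ : ∃[ j ] M ∈ rowAt UA j
        occ = occ' kℓ-split
          where
          occ' : k ≡ ℓ ⊎ ∃[ ℓ1 ] (suc ℓ1 ≡ ℓ × k ≤ ℓ1) → ∃[ j ] M ∈ rowAt UA j
          occ' (inj₁ e) = k , subst (λ w → w ∈ rowAt UA k) (x≡M e) (subst (x ∈_) (sym rA-k) (here refl))
          occ' (inj₂ (ℓ1 , e , le)) = suc ℓ1 , subst (M ∈_) (sym (rA-gt ℓ1 le)) (M∈last-row ℓ1 e le)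

      xeqA : x + suc ℓ ≡ M + suc k
      xeqA = trans (+-suc x ℓ) (trans (cong suc xeq) (sym (+-suc M k)))

      settled-tail-UA : ∀ j → suc k ≤ j → j < suc ℓ → Settled (suc ℓ) M σA UA j
      settled-tail-UA (suc j') (s≤s kj') (s≤s j'ℓ) = p1 (m≤n⇒m<n∨m≡n j'ℓ) , p2 , p3
        where
        p1 : suc j' < ℓ ⊎ suc j' ≡ ℓ → nth σA (suc j') ≡ suc (suc j')
        p1 (inj₁ lt) = trans (σA-lt (suc j') lt) (trans (cong (swapAdj k) (σ-tail (suc j') (≤-trans kj' (n≤1+n j')) lt)) (swapAdj-fix-> k _ (s≤s (s≤s kj'))))
        p1 (inj₂ e) = trans (cong (nth σA) e) (trans σA-ℓ (trans (cong (λ w → swapAdj k (suc w)) (sym e)) (swapAdj-fix-> k _ (s≤s (s≤s kj')))))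
        p2 : All (λ e → e + suc ℓ ≡ M + suc (suc j')) (rowAt UA (suc j'))
        p2 = subst (All _) (sym (rA-gt j' kj')) (All.map (λ {e} p → trans (+-suc e ℓ) (trans (cong suc p) (sym (+-suc M (suc j'))))) (row-tail j' kj' j'ℓ))
        p3 : ∀ j'' → j'' ≢ suc j' → All (λ e → e + suc ℓ ≢ M + suc (suc j')) (rowAt UA j'')
        p3 j'' ne = All.tabulate f
          where
          f : ∀ {e} → e ∈ rowAt UA j'' → e + suc ℓ ≢ M + suc (suc j')
          f {e} h eq with rowUA j'' h
          ... | inj₁ (lt , m) = ≤x⇒not-tail-value j' kj' e (entries-≤x j'' lt m) (shift e ℓ M (suc j') eq)
          ... | inj₂ (inj₁ (_ , refl)) = ≤x⇒not-tail-value j' kj' x ≤-refl (shift e ℓ M (suc j') eq)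
          ... | inj₂ (inj₂ (j3 , refl , le , m)) = All.lookup (tail-value-elsewhere j' kj' j'ℓ j3 (λ e3 → ne (cong suc e3))) m (shift e ℓ M (suc j') eq)

      unsettled-UA : ¬ Settled (suc ℓ) M σA UA k
      unsettled-UA (a , _) = 1+n≢n (trans (sym a) σA-k)

      minimal-UA : ∀ j → j < suc ℓ → x ∈ rowAt UA j → k ≤ nth σA j
      minimal-UA j _ h with rowUA j h
      ... | inj₁ (lt , m) rewrite xonly j m = subst (k ≤_) (sym σA-r0) (n≤1+n k)
      ... | inj₂ (inj₁ (refl , _)) = ≤-reflexive (sym σA-k)
      ... | inj₂ (inj₂ (j' , refl , le , m)) = ⊥-elim (<-irrefl refl (≤-trans (x-row<k j' m) le))

      unique-UA : ∀ j → j < suc ℓ → x ∈ rowAt UA j → nth σA j ≡ k → j ≡ k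
      unique-UA j _ h e with rowUA j h
      ... | inj₁ (lt , m) rewrite xonly j m = ⊥-elim (1+n≢n (trans (sym σA-r0) e))
      ... | inj₂ (inj₁ (refl , _)) = refl
      ... | inj₂ (inj₂ (j' , refl , le , m)) = ⊥-elim (<-irrefl refl (≤-trans (x-row<k j' m) le))

      ψ-UA : PsiAux.k σA UA ≡ suc k × ψ σA UA ≡ PsiAux.stepR σA UA (just (suc k , k))
      ψ-UA = ψ-from-spec σA UA (suc ℓ) M k x k k lenUA lenσA maxUA xeqA (s≤s c<ℓ) settled-tail-UA unsettled-UA (s≤s c<ℓ) (subst (x ∈_) (sym rA-k) (here refl)) σA-k minimal-UA unique-UA

      kτA : PsiAux.k σA UA ≡ suc k
      kτA = proj₁ ψ-UA

      posA : posOf (suc k) σA ≡ just (suc r0)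
      posA = posOf-first (suc k) σA r0 (subst (r0 <_) (sym lenσA) (<-trans r0ℓ (n<1+n ℓ))) σA-r0 pre
        where
        pre : ∀ i → i < r0 → nth σA i ≢ suc k
        pre i lt e = <-irrefl (σinj i r0 iℓ r0ℓ (trans (swapAdj≡suc⇒ k _ (trans (sym (σA-lt i iℓ)) e)) (sym (trans σr0 qk)))) lt
          where iℓ = <-trans lt r0ℓ

      xValue-UA : xValue UA k ≡ x
      xValue-UA = trans (cong₂ _∸_ (cong (_+ suc k) maxUA) lenUA) (cong (_∸ suc ℓ) (+-suc M k))

      U2 : Tableau
      U2 = moveEntry UA x (suc k) (suc r0)

      r0≢k : r0 ≢ k
      r0≢k e = <-irrefl e r0k

      lenUk : k < length UA
      lenUk = subst (k <_) (sym lenUA) (s≤s c<ℓ)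

      emp : rowAt U2 k ≡ []
      emp = trans (rowAt-updateAt-≢ r0 (λ row → row ++ [ x ]) (updateAt k dropLast UA) k (λ e → r0≢k (sym e)))
                  (trans (rowAt-updateAt-≡ k dropLast UA lenUk) (cong dropLast rA-k))

      lowAll : ∀ j → j < k → All (_≤ x) (rowAt S j)
      lowAll j lt = All.tabulate (entries-≤x j lt)

      lenU2 : length U2 ≡ suc ℓ
      lenU2 = trans (length-updateAt r0 (λ row → row ++ [ x ]) (updateAt k dropLast UA)) (trans (length-updateAt k dropLast UA) lenUA)

      remove-insert : removeAt k U2 ≡ S
      remove-insert = rowAt-ext _ S lenR f
        where
        lenR : length (removeAt k U2) ≡ ℓ
        lenR = suc-injective (trans (length-removeAt k U2 (subst (k <_) (sym lenU2) (s≤s c<ℓ))) lenU2)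
        f : ∀ j → j < length (removeAt k U2) → rowAt (removeAt k U2) j ≡ rowAt S j
        f j _ with j <? k
        ... | yes lt = trans (rowAt-removeAt-< k U2 j lt) (g (j ≟ r0))
          where
          g : Dec (j ≡ r0) → rowAt U2 j ≡ rowAt S j
          g (yes refl) = trans (rowAt-updateAt-≡ r0 (λ row → row ++ [ x ]) (updateAt k dropLast UA) (subst (r0 <_) (sym (trans (length-updateAt k dropLast UA) lenUA)) (<-trans r0ℓ (n<1+n ℓ))))
                           (trans (cong (_++ [ x ]) (trans (rowAt-updateAt-≢ k dropLast UA r0 r0≢k) (trans (rA-lt r0 r0k) S1-r0)))
                             (row-last r0 x xr0 (lowAll r0 r0k)))
          g (no ne) = trans (rowAt-updateAt-≢ r0 (λ row → row ++ [ x ]) (updateAt k dropLast UA) j ne) (trans (rowAt-updateAt-≢ k dropLast UA j (λ e → <-irrefl e lt)) (trans (rA-lt j lt) (S1-ne j ne)))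
        ... | no nlt = trans (rowAt-removeAt-≥ k U2 j (≮⇒≥ nlt))
                        (trans (rowAt-updateAt-≢ r0 (λ row → row ++ [ x ]) (updateAt k dropLast UA) (suc j) (λ e → <-irrefl refl (<-trans (n<1+n j) (≤-trans (subst (_< k) (sym e) r0k) (≮⇒≥ nlt)))))
                          (trans (rowAt-updateAt-≢ k dropLast UA (suc j) (λ e → nlt (≤-reflexive e)))
                            (rA-gt j (≮⇒≥ nlt))))

      ψ-UA-inverse : ψ σA UA ≡ (σ , S)
      ψ-UA-inverse = trans (proj₂ ψ-UA) (trans (stepR-move σA UA k (suc k) k (suc r0) kτA (λ e → 1+n≢n (sym e)) posA)
              (trans (cong (λ w → moveResult σA UA w (suc k) k (suc r0)) xValue-UA)
                (trans (moveResult-emptied σA UA x (suc k) k (suc r0) emp)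
                  (cong₂ _,_ (trans (cong dropLast (sAct-involutive k (σ ++ [ suc ℓ ]))) (dropLast-snoc σ (suc ℓ))) remove-insert))))

      sgn-σA : sgn σA ≡ - sgn σ
      sgn-σA = trans (sgn-sAct k (σ ++ [ suc ℓ ]) c1 (c2 kℓ-split)) (cong -_ (sgn-snoc-max σ (suc ℓ) σ≤suc-ℓ))
        where
        c1 : countL k (σ ++ [ suc ℓ ]) ≡ 1
        c1 = trans (countL-snoc k σ (suc ℓ)) (trans (cong₂ _+_ (countL-σ-≡1 k (s≤s z≤n) c<ℓ) (cong (λ b → if b then 1 else 0) (≢⇒≡ᵇ-false k (suc ℓ) (λ e → <-irrefl refl (subst (_≤ ℓ) e c<ℓ)) ))) refl)
        c2 : k ≡ ℓ ⊎ ∃[ ℓ1 ] (suc ℓ1 ≡ ℓ × k ≤ ℓ1) → countL (suc k) (σ ++ [ suc ℓ ]) ≡ 1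
        c2 (inj₁ e) rewrite e = trans (countL-snoc (suc ℓ) σ (suc ℓ)) (cong₂ _+_ countL-σ-suc-ℓ (cong (λ b → if b then 1 else 0) (≡ᵇ-refl ℓ)))
        c2 (inj₂ (ℓ1 , e , le)) = trans (countL-snoc (suc k) σ (suc ℓ)) (trans (cong₂ _+_ (countL-σ-≡1 (suc k) (s≤s z≤n) (subst (suc k ≤_) e (s≤s le))) (cong (λ b → if b then 1 else 0) (≢⇒≡ᵇ-false (suc k) (suc ℓ) (λ e2 → <-irrefl (suc-injective e2) (subst (k <_) e (s≤s le)))))) refl)

      sign-reversing-involution : SignReversingInvolutionAt σ S
      sign-reversing-involution rewrite ψ-S-insert = sgn-σA , ψ-UA-inverse

    module MoveCase (qne : q ≢ k) (p0 : ℕ) (p0ℓ : p0 < ℓ) (σp0 : nth σ p0 ≡ suc q) where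
      sqk : suc q ≤ k
      sqk = ≤∧≢⇒< qk qne

      p0k : p0 < k
      p0k with p0 <? k
      ... | yes lt = lt
      ... | no nlt = ⊥-elim (<-irrefl refl (≤-trans sqk (≤-trans (≮⇒≥ nlt) (≤-reflexive (suc-injective (trans (sym (σ-tail p0 (≮⇒≥ nlt) p0ℓ)) σp0))))))

      p0≢r0 : p0 ≢ r0
      p0≢r0 e = 1+n≢n (trans (sym σp0) (trans (cong (nth σ) e) σr0))

      posB : posOf (suc q) σ ≡ just (suc p0)
      posB = posOf-first (suc q) σ p0 (subst (p0 <_) (sym lenσ) p0ℓ) σp0 pre
        where
        pre : ∀ i → i < p0 → nth σ i ≢ suc q
        pre i lt e = <-irrefl (σinj i p0 (<-trans lt p0ℓ) p0ℓ (trans e (sym σp0))) lt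

      U : Tableau
      U = moveEntry S x (suc r0) (suc p0)
      σB : List ℕ
      σB = sAct q σ

      ψ-S-move : ψ σ S ≡ moveResult σ S x (suc r0) q (suc p0)
      ψ-S-move = trans ψ-eq (stepR-move σ S c (suc r0) q (suc p0) kc qne posB)

      lenS1 : length (updateAt r0 dropLast S) ≡ ℓ
      lenS1 = length-updateAt r0 dropLast S
      lenU : length U ≡ ℓ
      lenU = trans (length-updateAt p0 (λ row → row ++ [ x ]) (updateAt r0 dropLast S)) lenS1
      lenσB : length σB ≡ ℓ
      lenσB = trans (length-sAct q σ) lenσ

      rowU-p0 : rowAt U p0 ≡ rowAt S p0 ++ [ x ]
      rowU-p0 = trans (rowAt-updateAt-≡ p0 (λ row → row ++ [ x ]) (updateAt r0 dropLast S) (subst (p0 <_) (sym lenS1) p0ℓ)) (cong (_++ [ x ]) (rowAt-updateAt-≢ r0 dropLast S p0 p0≢r0))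
      rowU-r0 : rowAt U r0 ≡ dropLast (rowAt S r0)
      rowU-r0 = trans (rowAt-updateAt-≢ p0 (λ row → row ++ [ x ]) (updateAt r0 dropLast S) r0 (λ e → p0≢r0 (sym e))) (rowAt-updateAt-≡ r0 dropLast S r0ℓ)
      rowU-oth : ∀ j → j ≢ p0 → j ≢ r0 → rowAt U j ≡ rowAt S j
      rowU-oth j n1 n2 = trans (rowAt-updateAt-≢ p0 (λ row → row ++ [ x ]) (updateAt r0 dropLast S) j n1) (rowAt-updateAt-≢ r0 dropLast S j n2)

      rowU-mem : ∀ j {e} → e ∈ rowAt U j → e ∈ rowAt S j ⊎ (j ≡ p0 × e ≡ x)
      rowU-mem j {e} h with j ≟ p0
      ... | yes refl with ∈-snoc⁻ (rowAt S p0) x (subst (e ∈_) rowU-p0 h)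
      ...   | inj₁ m = inj₁ m
      ...   | inj₂ ex = inj₂ (refl , ex)
      rowU-mem j {e} h | no n1 with j ≟ r0
      ...   | yes refl = inj₁ (∈-dropLast (rowAt S r0) (subst (e ∈_) rowU-r0 h))
      ...   | no n2 = inj₁ (subst (e ∈_) (rowU-oth j n1 n2) h)

      σB-lt : ∀ j → j < ℓ → nth σB j ≡ swapAdj q (nth σ j)
      σB-lt j lt = nth-sAct q σ j (subst (j <_) (sym lenσ) lt)
      σB-p0 : nth σB p0 ≡ q
      σB-p0 = trans (σB-lt p0 p0ℓ) (trans (cong (swapAdj q) σp0) (swapAdj-suc q))
      σB-r0 : nth σB r0 ≡ suc q
      σB-r0 = trans (σB-lt r0 r0ℓ) (trans (cong (swapAdj q) σr0) (swapAdj-k q))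
      σB-tail : ∀ j → k ≤ j → j < ℓ → nth σB j ≡ suc j
      σB-tail j le lt = trans (σB-lt j lt) (trans (cong (swapAdj q) (σ-tail j le lt)) (swapAdj-fix-> q (suc j) (s≤s (≤-trans sqk le))))

      sgn-σB : sgn σB ≡ - sgn σ
      sgn-σB = sgn-sAct q σ (countL-σ-≡1 q q1 (≤-trans qk c<ℓ)) (countL-σ-≡1 (suc q) (s≤s z≤n) (≤-trans sqk c<ℓ))

      xU : ∀ j → x ∈ rowAt U j → j ≢ p0 → x ∈ rowAt S j
      xU j h ne with rowU-mem j h
      ... | inj₁ m = m
      ... | inj₂ (e , _) = ⊥-elim (ne e)

      xUp0 : x ∈ rowAt U p0
      xUp0 = subst (x ∈_) (sym rowU-p0) (∈-++⁺ʳ (rowAt S p0) (here refl))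

      entU-le : ∀ j {e} → e ∈ rowAt U j → e ≤ M
      entU-le j h with rowU-mem j h
      ... | inj₁ m = entry≤M j m
      ... | inj₂ (_ , refl) = x≤M

      maxU : maxEntry U ≡ M
      maxU = maxEntry-≡ U M (λ j → All.tabulate (entU-le j)) (occ kℓ-split)
        where
        occ : k ≡ ℓ ⊎ ∃[ ℓ1 ] (suc ℓ1 ≡ ℓ × k ≤ ℓ1) → ∃[ j ] M ∈ rowAt U j
        occ (inj₁ e) = p0 , subst (_∈ rowAt U p0) (x≡M e) xUp0
        occ (inj₂ (ℓ1 , e , le)) = ℓ1 , subst (M ∈_) (sym (rowU-oth ℓ1 (λ e2 → <-irrefl refl (≤-trans (subst (_< k) (sym e2) p0k) le)) (λ e2 → <-irrefl refl (≤-trans (subst (_< k) (sym e2) r0k) le)))) (M∈last-row ℓ1 e le)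

      xValue-U : xValue U c ≡ x
      xValue-U = cong₂ (λ a b → (a + suc c) ∸ b) maxU lenU

      posB' : posOf (suc q) σB ≡ just (suc r0)
      posB' = posOf-first (suc q) σB r0 (subst (r0 <_) (sym lenσB) r0ℓ) σB-r0 pre
        where
        pre : ∀ i → i < r0 → nth σB i ≢ suc q
        pre i lt e = <-irrefl (σinj i r0 (<-trans lt r0ℓ) r0ℓ (trans (swapAdj≡suc⇒ q _ (trans (sym (σB-lt i (<-trans lt r0ℓ))) e)) (sym σr0))) lt

      j≢p0-tail : ∀ j → k ≤ j → j ≢ p0
      j≢p0-tail j le e = <-irrefl refl (≤-trans (subst (_< k) (sym e) p0k) le)
      j≢r0-tail : ∀ j → k ≤ j → j ≢ r0
      j≢r0-tail j le e = <-irrefl refl (≤-trans (subst (_< k) (sym e) r0k) le)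

      settled-tail-U : ∀ j → suc c ≤ j → j < ℓ → Settled ℓ M σB U j
      settled-tail-U j le lt = σB-tail j le lt , subst (All _) (sym (rowU-oth j (j≢p0-tail j le) (j≢r0-tail j le))) (row-tail j le lt) , p3
        where
        p3 : ∀ j'' → j'' ≢ j → All (λ e → e + ℓ ≢ M + suc j) (rowAt U j'')
        p3 j'' ne = All.tabulate f
          where
          f : ∀ {e} → e ∈ rowAt U j'' → e + ℓ ≢ M + suc j
          f {e} h with rowU-mem j'' h
          ... | inj₁ m = All.lookup (tail-value-elsewhere j le lt j'' ne) m
          ... | inj₂ (_ , refl) = ≤x⇒not-tail-value j le x ≤-refl

      unsettled-U : ¬ Settled ℓ M σB U c
      unsettled-U (a , b , d) with p0 ≟ c
      ... | yes refl = qne (trans (sym σB-p0) a)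
      ... | no ne = All.lookup (d p0 ne) xUp0 xeq

      sw-ge : ∀ v → q ≤ v → v ≢ suc q → q ≤ swapAdj q v
      sw-ge v le ne with v ≟ q
      ... | yes refl = ≤-trans (n≤1+n q) (≤-reflexive (sym (swapAdj-k q)))
      ... | no ne2 = ≤-trans le (≤-reflexive (sym (swapAdj-fix q v ne2 ne)))

      minimal-U : ∀ j → j < ℓ → x ∈ rowAt U j → q ≤ nth σB j
      minimal-U j jl h with j ≟ p0
      ... | yes refl = ≤-reflexive (sym σB-p0)
      ... | no ne = subst (q ≤_) (sym (σB-lt j jl)) (sw-ge (nth σ j) (qmin j jl (xU j h ne)) (λ e → ne (σinj j p0 jl p0ℓ (trans e (sym σp0)))))

      unique-U : ∀ j → j < ℓ → x ∈ rowAt U j → nth σB j ≡ q → j ≡ p0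
      unique-U j jl h e = σinj j p0 jl p0ℓ (trans (swapAdj≡k⇒ q _ (trans (sym (σB-lt j jl)) e)) (sym σp0))

      nonempty-split : ∀ (row : List ℕ) → 1 ≤ length row → ∃[ a ] ∃[ as ] row ≡ a ∷ as
      nonempty-split (a ∷ as) _ = a , as , refl

      module MoveKeepsRow (a b : ℕ) (rest : List ℕ) (eqr : rowAt S r0 ≡ a ∷ b ∷ rest) where
        ψ-S-keep : ψ σ S ≡ (σB , U)
        ψ-S-keep = trans ψ-S-move (moveResult-nonEmpty σ S x (suc r0) q (suc p0) a (dropLast (b ∷ rest)) (trans rowU-r0 (cong dropLast eqr)))

        ψ-U : PsiAux.k σB U ≡ suc c × ψ σB U ≡ PsiAux.stepR σB U (just (suc p0 , q))
        ψ-U = ψ-from-spec σB U ℓ M c x p0 q lenU lenσB maxU xeq c<ℓ settled-tail-U unsettled-U p0ℓ xUp0 σB-p0 minimal-U unique-U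

        U' : Tableau
        U' = moveEntry U x (suc p0) (suc r0)

        lenUp0 : p0 < length U
        lenUp0 = subst (p0 <_) (sym lenU) p0ℓ

        rowU'-p0 : rowAt U' p0 ≡ rowAt S p0
        rowU'-p0 = trans (rowAt-updateAt-≢ r0 (λ row → row ++ [ x ]) (updateAt p0 dropLast U) p0 p0≢r0) (trans (rowAt-updateAt-≡ p0 dropLast U lenUp0) (trans (cong dropLast rowU-p0) (dropLast-snoc (rowAt S p0) x)))

        sp : ∃[ a ] ∃[ as ] rowAt S p0 ≡ a ∷ as
        sp = nonempty-split (rowAt S p0) (nonempty p0 p0ℓ)

        move-back : U' ≡ S
        move-back = rowAt-ext U' S lenU' f
          where
          lenU' : length U' ≡ ℓ
          lenU' = trans (length-updateAt r0 (λ row → row ++ [ x ]) (updateAt p0 dropLast U)) (trans (length-updateAt p0 dropLast U) lenU)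
          f : ∀ j → j < length U' → rowAt U' j ≡ rowAt S j
          f j _ with j ≟ p0
          ... | yes refl = rowU'-p0
          ... | no n1 with j ≟ r0
          ...   | yes refl = trans (rowAt-updateAt-≡ r0 (λ row → row ++ [ x ]) (updateAt p0 dropLast U) (subst (r0 <_) (sym (trans (length-updateAt p0 dropLast U) lenU)) r0ℓ))
                                (trans (cong (_++ [ x ]) (trans (rowAt-updateAt-≢ p0 dropLast U r0 (λ e → p0≢r0 (sym e))) rowU-r0))
                                  (row-last r0 x xr0 (All.tabulate (entries-≤x r0 r0k))))
          ...   | no n2 = trans (rowAt-updateAt-≢ r0 (λ row → row ++ [ x ]) (updateAt p0 dropLast U) j n2) (trans (rowAt-updateAt-≢ p0 dropLast U j n1) (rowU-oth j n1 n2))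

        ψ-U-inverse : ψ σB U ≡ (σ , S)
        ψ-U-inverse = trans (proj₂ ψ-U) (trans (stepR-move σB U c (suc p0) q (suc r0) (proj₁ ψ-U) qne posB')
                 (trans (cong (λ w → moveResult σB U w (suc p0) q (suc r0)) xValue-U)
                   (trans (moveResult-nonEmpty σB U x (suc p0) q (suc r0) (proj₁ sp) (proj₁ (proj₂ sp)) (trans rowU'-p0 (proj₂ (proj₂ sp))))
                     (cong₂ _,_ (sAct-involutive q σ) move-back))))

        sign-reversing-involution : SignReversingInvolutionAt σ S
        sign-reversing-involution rewrite ψ-S-keep = sgn-σB , ψ-U-inverse

      sw-le : ∀ v → v ≤ ℓ → swapAdj q v ≤ ℓ
      sw-le v le with v ≟ q
      ... | yes refl = ≤-trans (≤-reflexive (swapAdj-k v)) (≤-trans sqk c<ℓ)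
      ... | no n1 with v ≟ suc q
      ...   | yes refl = ≤-trans (≤-reflexive (swapAdj-suc q)) (≤-trans (n≤1+n q) le)
      ...   | no n2 = ≤-trans (≤-reflexive (swapAdj-fix q v n1 n2)) le

      σBℓ : All (_≤ ℓ) σB
      σBℓ = All.tabulate f
        where
        f : ∀ {v} → v ∈ σB → v ≤ ℓ
        f {v} h with countL-pos⇒nth v σB (∈⇒countL-pos v σB h)
        ... | (j , lt , refl) = subst (_≤ ℓ) (sym (σB-lt j jl)) (sw-le (nth σ j) (proj₂ (σrange j jl)))
          where jl = subst (j <_) lenσB lt

      -- ψ then takes step (4) on U and re-inserts the row.
      module MoveEmptiesRow (eqr : rowAt S r0 ≡ [ x ]) where
        r0≡c : r0 ≡ c
        r0≡c with m≤n⇒m<n∨m≡n (≤-pred r0k)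
        ... | inj₂ e = e
        ... | inj₁ lt = ⊥-elim (<-irrefl refl (≤-trans (subst (λ w → w < hd (rowAt S c)) (cong hd eqr) (hd-lt r0 c lt c<ℓ)) (entries-≤x c ≤-refl (hd-mem c c<ℓ))))

        q≡c : q ≡ c
        q≡c = ≤-antisym (≤-pred (≤∧≢⇒< qk qne)) (subst (_≤ q) r0≡c (≤-pred (subst (λ w → suc r0 ≤ length w + q) eqr (subst (λ w → suc r0 ≤ length (rowAt S r0) + w) σr0 (Δ-nonneg S σ α Hα lenσ r0 r0ℓ)))))

        c2 : ℕ
        c2 = pred c
        ec2 : suc c2 ≡ c
        ec2 = suc-pred c {{>-nonZero (subst (1 ≤_) q≡c q1)}}
        ℓ1 : ℕ
        ℓ1 = pred ℓ
        eℓ1 : suc ℓ1 ≡ ℓ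
        eℓ1 = suc-pred ℓ {{>-nonZero (≤-trans (s≤s z≤n) c<ℓ)}}

        ψ-S-empty : ψ σ S ≡ (dropLast σB , removeAt r0 U)
        ψ-S-empty = trans ψ-S-move (moveResult-emptied σ S x (suc r0) q (suc p0) (trans rowU-r0 (cong dropLast eqr)))

        U2 : Tableau
        U2 = removeAt r0 U
        σ2 : List ℕ
        σ2 = dropLast σB

        lenU2 : length U2 ≡ ℓ1
        lenU2 = suc-injective (trans (length-removeAt r0 U (subst (r0 <_) (sym lenU) r0ℓ)) (trans lenU (sym eℓ1)))
        lenσ2 : length σ2 ≡ ℓ1
        lenσ2 = trans (length-dropLast σB) (cong pred lenσB)

        p0<r0 : p0 < r0
        p0<r0 = ≤∧≢⇒< (subst (p0 ≤_) (sym r0≡c) (≤-pred p0k)) p0≢r0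

        rU2-lt : ∀ j → j < r0 → rowAt U2 j ≡ rowAt U j
        rU2-lt j lt = rowAt-removeAt-< r0 U j lt
        rU2-ge : ∀ j → r0 ≤ j → rowAt U2 j ≡ rowAt S (suc j)
        rU2-ge j le = trans (rowAt-removeAt-≥ r0 U j le) (rowU-oth (suc j) (λ e → <-irrefl (sym e) (s≤s (≤-trans (<⇒≤ p0<r0) le))) (λ e → <-irrefl (sym e) (s≤s le)))

        ksj : ∀ j → r0 ≤ j → k ≤ suc j
        ksj j le = s≤s (subst (_≤ j) r0≡c le)

        σ2-lt : ∀ j → j < ℓ1 → nth σ2 j ≡ swapAdj q (nth σ j)
        σ2-lt j lt = trans (nth-dropLast σB j (subst (suc j <_) (sym lenσB) (subst (suc j <_) eℓ1 (s≤s lt)))) (σB-lt j (<-trans lt (subst (ℓ1 <_) eℓ1 ≤-refl)))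

        rowU2-mem : ∀ j {e} → e ∈ rowAt U2 j → (j < r0 × (e ∈ rowAt S j ⊎ (j ≡ p0 × e ≡ x))) ⊎ (r0 ≤ j × e ∈ rowAt S (suc j))
        rowU2-mem j {e} h with j <? r0
        ... | yes lt = inj₁ (lt , rowU-mem j (subst (e ∈_) (rU2-lt j lt) h))
        ... | no nlt = inj₂ (≮⇒≥ nlt , subst (e ∈_) (rU2-ge j (≮⇒≥ nlt)) h)

        maxU2 : maxEntry U2 ≡ M
        maxU2 = maxEntry-≡ U2 M (λ j → All.tabulate (le j)) (occ kℓ-split)
          where
          le : ∀ j {e} → e ∈ rowAt U2 j → e ≤ M
          le j h with rowU2-mem j h
          ... | inj₁ (_ , inj₁ m) = entry≤M j m
          ... | inj₁ (_ , inj₂ (_ , refl)) = x≤M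
          ... | inj₂ (_ , m) = entry≤M (suc j) m
          xU2p0 : x ∈ rowAt U2 p0
          xU2p0 = subst (x ∈_) (sym (rU2-lt p0 p0<r0)) xUp0
          occ : k ≡ ℓ ⊎ ∃[ ℓ1 ] (suc ℓ1 ≡ ℓ × k ≤ ℓ1) → ∃[ j ] M ∈ rowAt U2 j
          occ (inj₁ e) = p0 , subst (_∈ rowAt U2 p0) (x≡M e) xU2p0
          occ (inj₂ (zero , e , ()))
          occ (inj₂ (suc j , e , le')) = j , subst (M ∈_) (sym (rU2-ge j (subst (_≤ j) (sym r0≡c) (≤-pred le')))) (M∈last-row (suc j) e le')

        xU2p0 : x ∈ rowAt U2 p0
        xU2p0 = subst (x ∈_) (sym (rU2-lt p0 p0<r0)) xUp0

        x2eq : x + ℓ1 ≡ M + suc c2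
        x2eq = shift x ℓ1 M (suc c2) (trans (cong (x +_) eℓ1) (trans xeq (cong (λ w → M + suc w) (sym ec2))))

        c2<ℓ1 : c2 < ℓ1
        c2<ℓ1 = ≤-pred (subst₂ _<_ (sym ec2) (sym eℓ1) c<ℓ)

        up : ∀ e j → e + ℓ1 ≡ M + suc j → e + ℓ ≡ M + suc (suc j)
        up e j h = trans (cong (e +_) (sym eℓ1)) (trans (+-suc e ℓ1) (trans (cong suc h) (sym (+-suc M (suc j)))))

        settled-tail-U2 : ∀ j → suc c2 ≤ j → j < ℓ1 → Settled ℓ1 M σ2 U2 j
        settled-tail-U2 j le lt = p1 , p2 , p3
          where
          r0j : r0 ≤ j
          r0j = subst (_≤ j) (trans ec2 (sym r0≡c)) le
          sjℓ : suc j < ℓ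
          sjℓ = subst (suc j <_) eℓ1 (s≤s lt)
          p1 : nth σ2 j ≡ suc j
          p1 with m≤n⇒m<n∨m≡n r0j
          ... | inj₂ refl = trans (σ2-lt r0 lt) (trans (cong (swapAdj q) σr0) (trans (swapAdj-k q) (cong suc (trans q≡c (sym r0≡c)))))
          ... | inj₁ r0<j = trans (σ2-lt j lt) (trans (cong (swapAdj q) (σ-tail j kj jℓ)) (swapAdj-fix-> q (suc j) (s≤s (≤-trans sqk kj))))
            where
            kj : k ≤ j
            kj = subst (_≤ j) (cong suc r0≡c) r0<j
            jℓ : j < ℓ
            jℓ = <-trans (n<1+n j) sjℓ
          p2 : All (λ e → e + ℓ1 ≡ M + suc j) (rowAt U2 j)
          p2 = subst (All _) (sym (rU2-ge j r0j)) (All.map (λ {e} h → shift e ℓ1 M (suc j) (trans (cong (e +_) eℓ1) h)) (row-tail (suc j) (ksj j r0j) sjℓ))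
          p3 : ∀ j'' → j'' ≢ j → All (λ e → e + ℓ1 ≢ M + suc j) (rowAt U2 j'')
          p3 j'' ne = All.tabulate f
            where
            f : ∀ {e} → e ∈ rowAt U2 j'' → e + ℓ1 ≢ M + suc j
            f {e} h eq with rowU2-mem j'' h
            ... | inj₁ (lt' , inj₁ m) = ≤x⇒not-tail-value (suc j) (ksj j r0j) e (entries-≤x j'' (<-trans lt' (subst (_< k) (sym r0≡c) ≤-refl)) m) (up e j eq)
            ... | inj₁ (_ , inj₂ (_ , refl)) = ≤x⇒not-tail-value (suc j) (ksj j r0j) x ≤-refl (up e j eq)
            ... | inj₂ (_ , m) = All.lookup (tail-value-elsewhere (suc j) (ksj j r0j) sjℓ (suc j'') (λ e2 → ne (suc-injective e2))) m (up e j eq)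

        unsettled-U2 : ¬ Settled ℓ1 M σ2 U2 c2
        unsettled-U2 (a , b , d) with p0 ≟ c2
        ... | no ne = All.lookup (d p0 ne) xU2p0 x2eq
        ... | yes e = <-irrefl refl (≤-trans (subst (λ w → hd (rowAt S p0) < w) (cong hd eqr) (hd-lt p0 r0 p0<r0 r0ℓ)) (≤-reflexive (sym hx)))
          where
          hmem : hd (rowAt S p0) ∈ rowAt U2 c2
          hmem = subst (λ w → hd (rowAt S p0) ∈ rowAt U2 w) e (subst (hd (rowAt S p0) ∈_) (sym (trans (rU2-lt p0 p0<r0) rowU-p0)) (∈-++⁺ˡ (hd-mem p0 p0ℓ)))
          hx : hd (rowAt S p0) ≡ x
          hx = +-cancelʳ-≡ ℓ1 _ x (trans (All.lookup b hmem) (sym x2eq))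

        onlyp0 : ∀ j → x ∈ rowAt U2 j → j ≡ p0
        onlyp0 j h with rowU2-mem j h
        ... | inj₁ (_ , inj₂ (e , _)) = e
        ... | inj₂ (le , m) = ⊥-elim (<-irrefl refl (≤-trans (x-row<k (suc j) m) (ksj j le)))
        ... | inj₁ (lt , inj₁ m) with j ≟ p0
        ...   | yes e = e
        ...   | no ne = ⊥-elim (vne2 (≤-antisym (≤-trans (σ≤k j jk) (≤-reflexive (cong suc (sym q≡c)))) (≤∧≢⇒< (qmin j jℓ m) (λ e → vne1 (sym e)))))
          where
          jℓ : j < ℓ
          jℓ = <-trans lt r0ℓ
          jk : j < k
          jk = <-trans lt r0k
          vne1 : nth σ j ≢ q
          vne1 e = <-irrefl (σinj j r0 jℓ r0ℓ (trans e (sym σr0))) lt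
          vne2 : nth σ j ≢ suc q
          vne2 e = ne (σinj j p0 jℓ p0ℓ (trans e (sym σp0)))

        p0ℓ1 : p0 < ℓ1
        p0ℓ1 = <-≤-trans p0<r0 (subst (_≤ ℓ1) (trans ec2 (sym r0≡c)) c2<ℓ1)

        σ2p0 : nth σ2 p0 ≡ c
        σ2p0 = trans (σ2-lt p0 p0ℓ1) (trans (cong (swapAdj q) σp0) (trans (swapAdj-suc q) q≡c))

        minimal-U2 : ∀ j → j < ℓ1 → x ∈ rowAt U2 j → c ≤ nth σ2 j
        minimal-U2 j _ h rewrite onlyp0 j h = ≤-reflexive (sym σ2p0)

        unique-U2 : ∀ j → j < ℓ1 → x ∈ rowAt U2 j → nth σ2 j ≡ c → j ≡ p0
        unique-U2 j _ h _ = onlyp0 j h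

        ψ-U2 : PsiAux.k σ2 U2 ≡ suc c2 × ψ σ2 U2 ≡ PsiAux.stepR σ2 U2 (just (suc p0 , c))
        ψ-U2 = ψ-from-spec σ2 U2 ℓ1 M c2 x p0 c lenU2 lenσ2 maxU2 x2eq c2<ℓ1 settled-tail-U2 unsettled-U2 p0ℓ1 xU2p0 σ2p0 minimal-U2 unique-U2

        nthB : nth σB ℓ1 ≡ ℓ
        nthB = f kℓ-split
          where
          f : k ≡ ℓ ⊎ ∃[ ℓ1 ] (suc ℓ1 ≡ ℓ × k ≤ ℓ1) → nth σB ℓ1 ≡ ℓ
          f (inj₁ e) = trans (cong (nth σB) l1r0) (trans σB-r0 (trans (cong suc q≡c) e))
            where
            l1r0 : ℓ1 ≡ r0
            l1r0 = suc-injective (trans eℓ1 (trans (sym e) (cong suc (sym r0≡c))))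
          f (inj₂ (ℓ1' , e , le)) = trans (cong (nth σB) (sym l1)) (trans (σB-tail ℓ1' le (subst (ℓ1' <_) e ≤-refl)) e)
            where
            l1 : ℓ1' ≡ ℓ1
            l1 = suc-injective (trans e (sym eℓ1))

        splitB : σ2 ++ [ ℓ ] ≡ σB
        splitB = dropLast-snoc-last σB ℓ1 ℓ (trans lenσB (sym eℓ1)) nthB

        e1 : sAct (suc c2) (σ2 ++ [ suc (length U2) ]) ≡ σ
        e1 = trans (cong₂ (λ a b → sAct a (σ2 ++ [ b ])) ec2 (trans (cong suc lenU2) eℓ1))
               (trans (cong (sAct c) splitB) (trans (cong (λ w → sAct w σB) (sym q≡c)) (sAct-involutive q σ)))

        xValue-U2 : xValue U2 c2 ≡ x
        xValue-U2 = trans (cong₂ (λ a b → (a + suc c2) ∸ b) maxU2 lenU2) (sym xx)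
          where
          xx : x ≡ (M + suc c2) ∸ ℓ1
          xx = trans (cong₂ (λ a b → (M + suc a) ∸ b) (sym ec2) (sym eℓ1)) (cong (_∸ suc ℓ1) (+-suc M (suc c2)))

        W : Tableau
        W = updateAt p0 dropLast U2
        lenW : length W ≡ ℓ1
        lenW = trans (length-updateAt p0 dropLast U2) lenU2
        cW : c ≤ length W
        cW = subst (c ≤_) (sym lenW) (subst (_≤ ℓ1) ec2 c2<ℓ1)

        insert-remove : insertAt c [ x ] W ≡ S
        insert-remove = rowAt-ext _ S lenI f
          where
          lenI : length (insertAt c [ x ] W) ≡ ℓ
          lenI = trans (length-insertAt c [ x ] W cW) (trans (cong suc lenW) eℓ1)
          f : ∀ j → j < length (insertAt c [ x ] W) → rowAt (insertAt c [ x ] W) j ≡ rowAt S j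
          f j _ with <-cmp j c
          ... | tri< lt _ _ = trans (rowAt-insertAt-< c [ x ] W j lt cW) (g (j ≟ p0))
            where
            jr0 : j < r0
            jr0 = subst (j <_) (sym r0≡c) lt
            g : Dec (j ≡ p0) → rowAt W j ≡ rowAt S j
            g (yes refl) = trans (rowAt-updateAt-≡ p0 dropLast U2 (subst (p0 <_) (sym lenU2) p0ℓ1))
                             (trans (cong dropLast (trans (rU2-lt p0 p0<r0) rowU-p0)) (dropLast-snoc (rowAt S p0) x))
            g (no ne) = trans (rowAt-updateAt-≢ p0 dropLast U2 j ne) (trans (rU2-lt j jr0) (rowU-oth j ne (λ e → <-irrefl e jr0)))
          ... | tri≈ _ refl _ = trans (rowAt-insertAt-≡ c [ x ] W cW) (trans (sym eqr) (cong (rowAt S) r0≡c))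
          ... | tri> _ _ gt with j
          ...   | suc j' = trans (rowAt-insertAt-> c [ x ] W j' (≤-pred gt) cW)
                     (trans (rowAt-updateAt-≢ p0 dropLast U2 j' (λ e → <-irrefl (sym e) (<-≤-trans (subst (p0 <_) r0≡c p0<r0) (≤-pred gt))))
                       (rU2-ge j' (subst (_≤ j') (sym r0≡c) (≤-pred gt))))

        σ2ℓ : All (_≤ ℓ) σ2
        σ2ℓ = All.tabulate (λ h → All.lookup σBℓ (∈-dropLast σB h))

        sgn-σ2 : sgn σ2 ≡ - sgn σ
        sgn-σ2 = trans (sym (sgn-snoc-max σ2 ℓ σ2ℓ)) (trans (cong sgn splitB) sgn-σB)

        ψ-U2-inverse : ψ σ2 U2 ≡ (σ , S)
        ψ-U2-inverse = trans (proj₂ ψ-U2) (trans (stepR-insert σ2 U2 c2 (suc p0) c (proj₁ ψ-U2) (sym ec2))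
                 (cong₂ _,_ e1 (trans (cong₂ (λ a b → insertAt a [ b ] W) ec2 xValue-U2) insert-remove)))

        sign-reversing-involution : SignReversingInvolutionAt σ S
        sign-reversing-involution rewrite ψ-S-empty = sgn-σ2 , ψ-U2-inverse

      sign-reversing-involution : SignReversingInvolutionAt σ S
      sign-reversing-involution = rowcase (rowAt S r0) refl
        where
        rowcase : (row : List ℕ) → rowAt S r0 ≡ row → SignReversingInvolutionAt σ S
        rowcase [] e = ⊥-elim (<-irrefl refl (subst (λ w → 1 ≤ length w) e (nonempty r0 r0ℓ)))
        rowcase (a ∷ []) e = MoveEmptiesRow.sign-reversing-involution (trans e (cong [_] (sym ax)))
          where
          ax : x ≡ a
          ax with subst (x ∈_) e xr0
          ... | here h = h
        rowcase (a ∷ b ∷ rest) e = MoveKeepsRow.sign-reversing-involution a b rest e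

    sign-reversing-involution : SignReversingInvolutionAt σ S
    sign-reversing-involution with q ≟ k
    ... | yes e = InsertCase.sign-reversing-involution e
    ... | no ne = goB (σsurj (suc q) (s≤s z≤n) (≤-trans (≤∧≢⇒< qk ne) c<ℓ))
      where
      goB : ∃[ j ] (j < ℓ × nth σ j ≡ suc q) → SignReversingInvolutionAt σ S
      goB (p0 , p0ℓ , σp0) = MoveCase.sign-reversing-involution ne p0 p0ℓ σp0

  sign-reversing-involution : SignReversingInvolutionAt σ S
  sign-reversing-involution = go (best-exists lenσ (proj₁ x-occurs , x∈⇒containsX _ (proj₂ (proj₂ x-occurs))))
    where
    go : (∃[ r0 ] ∃[ q ] (PsiAux.best σ S 1 σ S nothing ≡ just (suc r0 , q) × r0 < length S × containsX (rowAt S r0) ≡ true × nth σ r0 ≡ q × MinimalAt σ S q)) →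
         SignReversingInvolutionAt σ S
    go (r0 , q , beq , r0ℓ , b , σr0 , mn) = MinimalRow.sign-reversing-involution r0 q beq r0ℓ (containsX⇒x∈ _ b) σr0 (λ j lt xm → mn j (subst (j <_) (sym lenσ) lt) (x∈⇒containsX _ xm))

countL-const : ∀ a r → All (_≡ a) r → countL a r ≡ length r
countL-const a [] _ = refl
countL-const a (e ∷ r) (refl ∷ ps) rewrite ≡ᵇ-refl e = cong suc (countL-const e r ps)

countL-const-≢ : ∀ a w r → All (_≡ a) r → w ≢ a → countL w r ≡ 0
countL-const-≢ a w [] _ _ = refl
countL-const-≢ a w (e ∷ r) (refl ∷ ps) ne rewrite ≢⇒≡ᵇ-false w e ne = countL-const-≢ a w r ps ne

staircase-tail : ∀ o (S : Tableau) r → (∀ j → All (_≡ suc (o + j)) (rowAt (r ∷ S) j)) → ∀ j → All (_≡ suc (suc o + j)) (rowAt S j)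
staircase-tail o S r h j = subst (λ w → All (_≡ w) (rowAt S j)) (cong suc (+-suc o j)) (h (suc j))

countT-staircase-below : ∀ o (S : Tableau) → (∀ j → All (_≡ suc (o + j)) (rowAt S j)) → ∀ w → w ≤ o → countT w S ≡ 0
countT-staircase-below o [] h w le = refl
countT-staircase-below o (r ∷ S) h w le = cong₂ _+_ (countL-const-≢ _ w r (h 0) ne) (countT-staircase-below (suc o) S (staircase-tail o S r h) w (≤-trans le (n≤1+n o)))
  where
  ne : w ≢ suc (o + 0)
  ne e = <-irrefl refl (≤-trans (≤-reflexive (sym (trans e (cong suc (+-identityʳ o))))) le)

countT-staircase : ∀ o (S : Tableau) → (∀ j → All (_≡ suc (o + j)) (rowAt S j)) → ∀ v → countT (suc (o + v)) S ≡ nth (shape S) v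
countT-staircase o [] h v = refl
countT-staircase o (r ∷ S) h zero = trans (cong₂ _+_ (countL-const _ r (h 0)) (countT-staircase-below (suc o) S (staircase-tail o S r h) (suc (o + 0)) (s≤s (≤-reflexive (+-identityʳ o))))) (+-identityʳ (length r))
countT-staircase o (r ∷ S) h (suc v) = cong₂ _+_ (countL-const-≢ _ _ r (h 0) ne) (trans (cong (λ w → countT (suc w) S) (+-suc o v)) (countT-staircase (suc o) S (staircase-tail o S r h) v))
  where
  ne : suc (o + suc v) ≢ suc (o + 0)
  ne e = 1+n≢0 (+-cancelˡ-≡ o (suc v) 0 (suc-injective e))

nth-ext-pos : ∀ A B′ → All (1 ≤_) A → All (1 ≤_) B′ → (∀ v → nth A v ≡ nth B′ v) → A ≡ B′
nth-ext-pos [] [] _ _ _ = refl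
nth-ext-pos [] (b ∷ B′) _ (p ∷ _) h = ⊥-elim (<-irrefl refl (≤-trans p (≤-reflexive (sym (h 0)))))
nth-ext-pos (a ∷ A) [] (p ∷ _) _ h = ⊥-elim (<-irrefl refl (≤-trans p (≤-reflexive (h 0))))
nth-ext-pos (a ∷ A) (b ∷ B′) (_ ∷ pa) (_ ∷ pb) h = cong₂ _∷_ (h 0) (nth-ext-pos A B′ pa pb (λ v → h (suc v)))

deltaℕ-id : ∀ i γ σ → length γ ≡ length σ → (∀ j → j < length σ → nth σ j ≡ i + j) → deltaℕ i γ σ ≡ γ
deltaℕ-id i [] [] _ _ = refl
deltaℕ-id i (g ∷ γ) (s ∷ σ) l h = cong₂ _∷_ (trans (cong (λ w → (g + w) ∸ i) (trans (h 0 (s≤s z≤n)) (+-identityʳ i))) (m+n∸n≡m g i))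
  (deltaℕ-id (suc i) γ σ (suc-injective l) (λ j lt → trans (h (suc j) (s≤s lt)) (+-suc i j)))

dropZeros-pos : ∀ γ → All (1 ≤_) γ → dropZeros γ ≡ γ
dropZeros-pos [] _ = refl
dropZeros-pos (suc g ∷ γ) (_ ∷ ps) = cong (suc g ∷_) (dropZeros-pos γ ps)

shape-pos : ∀ (S : Tableau) → All NonEmpty S → All (1 ≤_) (shape S)
shape-pos [] _ = []
shape-pos (r ∷ S) (p ∷ ps) = p ∷ shape-pos S ps

sum-pos≡0⇒[] : ∀ β → All (1 ≤_) β → sum β ≡ 0 → β ≡ []
sum-pos≡0⇒[] [] _ _ = refl
sum-pos≡0⇒[] (b ∷ β) (p ∷ _) e = ⊥-elim (<-irrefl refl (≤-trans (≤-trans p (m≤m+n b (sum β))) (≤-reflexive e)))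

zero-or-suc : ∀ m → m ≡ 0 ⊎ ∃[ c ] m ≡ suc c
zero-or-suc zero = inj₁ refl
zero-or-suc (suc c) = inj₂ (c , refl)

module Content (α β σ : List ℕ) (S : Tableau)
  (βpos : All (1 ≤_) β) (sumα≡sumβ : sum α ≡ sum β)
  (Pσ : IsPerm σ) (lenσ : length σ ≡ length S) (Imm : IsImmaculate S)
  (Hα : HasContentTHC (shape S) σ α) (Hβ : HasContentT S β) where

  ℓ : ℕ
  ℓ = length S
  M : ℕ
  M = maxEntry S
  γ : List ℕ
  γ = shape S
  open ImmaculateFacts (immaculateFacts S Imm)

  lenγ : length γ ≡ ℓ
  lenγ = LP.length-map length S

  lenγ≡lenσ : length γ ≡ length σ
  lenγ≡lenσ = trans lenγ (sym lenσ)

  Δ-nonneg′ : ∀ j → j < length γ → j < length σ → 1 + j ≤ nth γ j + nth σ j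
  Δ-nonneg′ j a b = subst (λ w → suc j ≤ w + nth σ j) (sym (nth-shape S j)) (Δ-nonneg S σ α Hα lenσ j (subst (j <_) lenγ a))

  α≡dropZeros-Δ : α ≡ dropZeros (deltaℕ 1 γ σ)
  α≡dropZeros-Δ = map-pos-injective (sym (trans (sym (fl-map-pos (deltaℕ 1 γ σ))) (trans (cong fl (sym (Δ≡map-pos-deltaℕ 1 γ σ Δ-nonneg′))) Hα)))

  rows-beyond : ∀ {P : ℕ → Set} j → ¬ (j < ℓ) → All P (rowAt S j)
  rows-beyond j n = subst (All _) (sym (rowAt-beyond S j (≮⇒≥ n))) []

  entries-bounded : ∀ j → All (λ e → 1 ≤ e × e < 1 + length β) (rowAt S j)
  entries-bounded j = All.tabulate bounded
    where
    bounded : ∀ {e} → e ∈ rowAt S j → 1 ≤ e × e < 1 + length β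
    bounded {e} h = e1 , lt
      where
      e1 : 1 ≤ e
      e1 = ≤-trans (s≤s z≤n) (All.lookup (entries-ge j) h)
      se : suc (pred e) ≡ e
      se = suc-pred e {{>-nonZero e1}}
      occurs : 1 ≤ nth β (pred e)
      occurs = subst (1 ≤_) (Hβ (pred e)) (subst (λ w → 1 ≤ countT w S) (sym se) (∈⇒countT-pos e S j h))
      lt : e < 1 + length β
      lt with pred e <? length β
      ... | yes l = subst (_< 1 + length β) se (s≤s l)
      ... | no nl = ⊥-elim (<-irrefl refl (≤-trans occurs (≤-reflexive (nth-beyond β (pred e) (≮⇒≥ nl)))))

  IsStaircase : Set
  IsStaircase = (∀ j → j < ℓ → nth σ j ≡ suc j) × (∀ j → All (_≡ suc j) (rowAt S j))

  α≡β⇒staircase : α ≡ β → IsStaircase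
  α≡β⇒staircase α≡β = σ-id , weight-shape-≡-entrySum 1 S entries-ge wγ≡wS
    where
    wΔ wγ wS : ℕ
    wΔ = weight 1 (deltaℕ 1 γ σ)
    wγ = weight 1 γ
    wS = sum (map sum S)
    wα≤wΔ : weight 1 α ≤ wΔ
    wα≤wΔ = subst (λ w → weight 1 w ≤ wΔ) (sym α≡dropZeros-Δ) (weight-dropZeros-≤ 1 (deltaℕ 1 γ σ))
    wΔ-identity : 2 * wΔ + sqDistSum 1 γ σ ≡ 2 * wγ
    wΔ-identity = +-cancelʳ-≡ (indexSquareSum 1 γ σ) _ _
      (trans (weight-deltaℕ-identity 1 γ σ lenγ≡lenσ Δ-nonneg′) (cong (2 * wγ +_) (squareSum-perm γ σ lenγ≡lenσ Pσ)))
    wγ≤wS : wγ ≤ wS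
    wγ≤wS = weight-shape-≤-entrySum 1 S entries-ge
    wS≤wΔ : wS ≤ wΔ
    wS≤wΔ = subst (_≤ wΔ) (trans (cong (weight 1) α≡β) (weight-content≡entrySum S β Hβ entries-bounded)) wα≤wΔ
    wΔ≤wγ : wΔ ≤ wγ
    wΔ≤wγ = *-cancelˡ-≤ 2 (≤-trans (m≤m+n (2 * wΔ) (sqDistSum 1 γ σ)) (≤-reflexive wΔ-identity))
    wγ≡wS : wγ ≡ wS
    wγ≡wS = ≤-antisym wγ≤wS (≤-trans wS≤wΔ wΔ≤wγ)
    wΔ≡wγ : wΔ ≡ wγ
    wΔ≡wγ = ≤-antisym wΔ≤wγ (≤-trans wγ≤wS wS≤wΔ)
    sqDistSum≡0 : sqDistSum 1 γ σ ≡ 0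
    sqDistSum≡0 = +-cancelˡ-≡ (2 * wΔ) _ 0 (trans wΔ-identity (trans (cong (2 *_) (sym wΔ≡wγ)) (sym (+-identityʳ _))))
    σ-id : ∀ j → j < ℓ → nth σ j ≡ suc j
    σ-id j lt = sqDistSum≡0⇒id 1 γ σ sqDistSum≡0 j (subst (j <_) (sym lenγ) lt) (subst (j <_) (sym lenσ) lt)

  staircase-maxEntry : IsStaircase → 0 < ℓ → M ≡ ℓ
  staircase-maxEntry (_ , rowid) 0<ℓ = maxEntry-≡ S ℓ bounded (ℓ1 , subst (_∈ rowAt S ℓ1) (trans (All.lookup (rowid ℓ1) (hd-mem ℓ1 l1)) eℓ1) (hd-mem ℓ1 l1))
    where
    ℓ1 : ℕ
    ℓ1 = pred ℓ
    eℓ1 : suc ℓ1 ≡ ℓ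
    eℓ1 = suc-pred ℓ {{>-nonZero 0<ℓ}}
    l1 : ℓ1 < ℓ
    l1 = subst (ℓ1 <_) eℓ1 ≤-refl
    bounded : ∀ j → All (_≤ ℓ) (rowAt S j)
    bounded j with j <? ℓ
    ... | yes lt = All.map (λ e → ≤-trans (≤-reflexive e) lt) (rowid j)
    ... | no nlt = rows-beyond j nlt

  staircase⇒Settled : IsStaircase → ∀ c → c < ℓ → Settled ℓ M σ S c
  staircase⇒Settled st@(σid , rowid) c c<ℓ =
    σid c c<ℓ ,
    All.map (λ {e} p → trans (cong (_+ ℓ) p) (trans (+-comm (suc c) ℓ) (cong (_+ suc c) (sym M≡ℓ)))) (rowid c) ,
    λ j ne → All.map (λ {e} p q → ne (suc-injective (+-cancelʳ-≡ ℓ _ _ (trans (trans (cong (_+ ℓ) (sym p)) q) (trans (cong (_+ suc c) M≡ℓ) (+-comm ℓ (suc c))))))) (rowid j)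
    where
    M≡ℓ : M ≡ ℓ
    M≡ℓ = staircase-maxEntry st (≤-<-trans z≤n c<ℓ)

  α≡β⇒k≢suc : ∀ c → PsiAux.k σ S ≡ suc c → α ≢ β
  α≡β⇒k≢suc c kc α≡β = PsiInvolution.unsettled-k σ S α β Pσ lenσ Imm Hα Hβ βpos c kc
    (staircase⇒Settled (α≡β⇒staircase α≡β) c (PsiInvolution.c<ℓ σ S α β Pσ lenσ Imm Hα Hβ βpos c kc))

  k≡0⇒settled : PsiAux.k σ S ≡ 0 → ∀ c → c < ℓ → Settled ℓ M σ S c
  k≡0⇒settled k0 c lt = good⇒Settled c (proj₁ (proj₂ (kFrom-spec ℓ)) c (subst (_≤ c) (sym k0) z≤n) lt)
    where open PsiSpec σ S

  k≡0⇒staircase : PsiAux.k σ S ≡ 0 → 0 < ℓ → ∀ j → All (_≡ suc (0 + j)) (rowAt S j)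
  k≡0⇒staircase k0 0<ℓ j with j <? ℓ
  ... | no nlt = rows-beyond j nlt
  ... | yes lt = All.map (λ {e} p → +-cancelʳ-≡ ℓ e (suc j) (trans p (trans (cong (_+ suc j) M≡ℓ) (+-comm ℓ (suc j))))) (proj₁ (proj₂ (k≡0⇒settled k0 j lt)))
    where
    first : hd (rowAt S 0) ∈ rowAt S 0
    first = hd-mem 0 0<ℓ
    M≡ℓ : M ≡ ℓ
    M≡ℓ with values-occur S β Hβ βpos (immaculateFacts S Imm) 0 _ first 1 ≤-refl
               (≤-trans (All.lookup (entries-ge 0) first) (maxEntry-ub S 0 _ first))
    ... | (j , lt , m) with All.lookup (entries-ge j) m
    ...   | s≤s z≤n = +-cancelʳ-≡ 1 M ℓ (trans (sym (All.lookup (proj₁ (proj₂ (k≡0⇒settled k0 0 lt))) m)) (+-comm 1 ℓ))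

  k≡0⇒α≡β : PsiAux.k σ S ≡ 0 → α ≡ β
  k≡0⇒α≡β k0 with ℓ ≟ 0
  ... | yes ℓ≡0 = trans α≡[] (sym (sum-pos≡0⇒[] β βpos (trans (sym sumα≡sumβ) (cong sum α≡[]))))
    where
    deltaℕ-[] : ∀ γ′ → length γ′ ≡ 0 → deltaℕ 1 γ′ σ ≡ []
    deltaℕ-[] [] _ = refl
    α≡[] : α ≡ []
    α≡[] = trans α≡dropZeros-Δ (cong dropZeros (deltaℕ-[] γ (trans lenγ ℓ≡0)))
  ... | no ℓ≢0 = trans α≡γ (sym β≡γ)
    where
    0<ℓ : 0 < ℓ
    0<ℓ = n≢0⇒n>0 ℓ≢0
    γ-pos : All (1 ≤_) γ
    γ-pos = shape-pos S (proj₁ Imm)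
    β≡γ : β ≡ γ
    β≡γ = nth-ext-pos β γ βpos γ-pos (λ v → trans (sym (Hβ v)) (countT-staircase 0 S (k≡0⇒staircase k0 0<ℓ) v))
    α≡γ : α ≡ γ
    α≡γ = trans α≡dropZeros-Δ (trans (cong dropZeros (deltaℕ-id 1 γ σ lenγ≡lenσ (λ j lt → proj₁ (k≡0⇒settled k0 j (subst (j <_) lenσ lt))))) (dropZeros-pos γ γ-pos))

theorem4p4 : (n : ℕ) (α β σ : List ℕ) (S : List (List ℕ)) →
    IsComposition n α → IsComposition n β → InC α β σ S →
    (α ≡ β → ψ σ S ≡ (σ , S)) ×
    (α ≢ β → sgn (proj₁ (ψ σ S)) ≡ - sgn σ ×
    ψ (proj₁ (ψ σ S)) (proj₂ (ψ σ S)) ≡ (σ , S))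
theorem4p4 n α β σ S (_ , sumα) (βpos , sumβ) (Pσ , lenσ , Imm , Hα , Hβ) = part₁ , part₂
  where
  open Content α β σ S βpos (trans sumα (sym sumβ)) Pσ lenσ Imm Hα Hβ

  part₁ : α ≡ β → ψ σ S ≡ (σ , S)
  part₁ α≡β with zero-or-suc (PsiAux.k σ S)
  ... | inj₁ k≡0 = ψ-k≡0 σ S k≡0
  ... | inj₂ (c , k≡suc) = ⊥-elim (α≡β⇒k≢suc c k≡suc α≡β)

  part₂ : α ≢ β → SignReversingInvolutionAt σ S
  part₂ α≢β with zero-or-suc (PsiAux.k σ S)
  ... | inj₁ k≡0 = ⊥-elim (α≢β (k≡0⇒α≡β k≡0))
  ... | inj₂ (c , k≡suc) = PsiInvolution.sign-reversing-involution σ S α β Pσ lenσ Imm Hα Hβ βpos c k≡suc
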